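{- Let $G$ be a graph on $n$ vertices with vertex set $V$, and let $\{V_0,\dots,V_m\}$ (together with some $G'$) be an $(\varepsilon,d)$-regular partition of $G$. Let $p > 0$ and let $B \subset V$ be a vertex set satisfying $V_0 \subset B$ and $|B \cap V_i| \le 10p|V_i|$ for every $i \in [m]$. If $\frac{m \log n}{\sqrt n} < p < \frac{1}{100}$ and $\varepsilon < \frac{1}{10}$, then there is a set $A \subset V \setminus B$ with the following properties: (a) $|A| \ge (p/2)n$; (b) $|A \cap V_i| \le 2p|V_i|$ for every $i \in [m]$; (c) $\deg(v, A\cap V_i) \ge (p/2)\deg(v,V_i)$ for every $v \in V$ and $i \in [m]$ with $\deg(v,V_i) > 30p|V_i|$; (d) $\deg(v,A) \ge |A|/100$ for every vertex $v \in V$ with $\deg(v, V\setminus B) > n/40$.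
   Context: $\deg(v,W)$ denotes the number of neighbours of $v$ in $W$ (in $G$). For disjoint vertex sets $V,W$, $d(V,W)=e(V,W)/(|V||W|)$ and $(V,W)$ is $\varepsilon$-regular if all $X\subset V$, $Y\subset W$ with $|X|\ge\varepsilon|V|$, $|Y|\ge\varepsilon|W|$ satisfy $|d(X,Y)-d(V,W)|\le\varepsilon$. Viewing $G$ as $r$-edge-coloured for some $r$, an $(\varepsilon,d)$-regular partition consists of a partition $\{V_0,\dots,V_m\}$ of $V(G)$ and a subgraph $G'$ of $G$ on $V(G)\setminus V_0$ such that: $m\ge 1/\varepsilon$; $|V_0|\le\varepsilon n$ and $|V_1|=\dots=|V_m|\le\varepsilon n$; $\deg_{G'}(v)\ge\deg_G(v)-(rd+\varepsilon)n$ for all $v\in V(G)\setminus V_0$; $G'[V_i]$ has no edges; and for all $i\neq j$ in $[m]$ and every colour, $(V_i,V_j)$ is $\varepsilon$-regular in the colour subgraph of $G'$ with density $0$ or at least $d$.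
   Formalization: The parameters ε, d and p, both of the regular partition and of the proposition, take rational values. -}

module Defs where

open import Data.Bool using (Bool; true; false; if_then_else_; _∧_)
open import Data.Nat as ℕ using (ℕ; zero; suc)
open import Data.Integer using (+_)
open import Data.Fin as Fin using (Fin; zero; suc)
open import Data.Fin.Subset as Sub using (Subset; _∈_; _∉_; _⊆_; _∩_; ∁)
open import Data.Vec using (tabulate; lookup)
open import Data.List using (List; allFin; map)
open import Data.Nat.ListAction using (sum)
open import Data.Rational as ℚ using (ℚ; _/_; 0ℚ; 1ℚ; _+_; _*_; _-_; _≤_; _<_)
open import Data.Product using (Σ; _×_; ∃; ∃-syntax; _,_; proj₁)
open import Data.Sum using (_⊎_)
open import Relation.Nullary.Decidable using (⌊_⌋)
open import Relation.Binary.PropositionalEquality using (_≡_; _≢_)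
open import Relation.Nullary using (¬_)

ℕ→ℚ : ℕ → ℚ
ℕ→ℚ k = + k / 1

card : ∀ {n} → Subset n → ℕ
card = Sub.∣_∣

record Graph (n : ℕ) : Set where
  field
    adj   : Fin n → Fin n → Bool
    sym   : ∀ u v → adj u v ≡ adj v u
    irrfl : ∀ v → adj v v ≡ false
open Graph public

nbhd : ∀ {n} → (Fin n → Fin n → Bool) → Fin n → Subset n
nbhd E v = tabulate (λ u → E v u)

degIn : ∀ {n} → (Fin n → Fin n → Bool) → Fin n → Subset n → ℕ
degIn E v W = card (W ∩ nbhd E v)

deg : ∀ {n} → (Fin n → Fin n → Bool) → Fin n → ℕ
deg {n} E v = degIn E v (tabulate (λ _ → true))

eCount : ∀ {n} → (Fin n → Fin n → Bool) → Subset n → Subset n → ℕ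
eCount {n} E X Y = sum (map (λ v → if lookup X v then degIn E v Y else 0) (allFin n))

-- d(X, Y) = e(X, Y) / (|X||Y|)  (convention: 0 if X or Y is empty)
density : ∀ {n} → (Fin n → Fin n → Bool) → Subset n → Subset n → ℚ
density E X Y with card X ℕ.* card Y
... | zero  = 0ℚ
... | suc k = + eCount E X Y / suc k

IsRegular : ∀ {n} → ℚ → (Fin n → Fin n → Bool) → Subset n → Subset n → Set
IsRegular {n} ε E V W =
  ∀ (X Y : Subset n) → X ⊆ V → Y ⊆ W →
    ε * ℕ→ℚ (card V) ≤ ℕ→ℚ (card X) →
    ε * ℕ→ℚ (card W) ≤ ℕ→ℚ (card Y) →
    ℚ.∣ density E X Y - density E V W ∣ ≤ ε

colourAdj : ∀ {n r} → (Fin n → Fin n → Bool) → (Fin n → Fin n → Fin r) → Fin r →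
            Fin n → Fin n → Bool
colourAdj E c k u v = E u v ∧ ⌊ c u v Fin.≟ k ⌋

-- {V_0, …, V_m} given as P : Fin (suc m) → Subset n, with P zero = V_0 and
-- P (suc i) = V_{i+1}; G' is a subgraph of G.
record IsRegularPartition {n r : ℕ} (G : Graph n) (c : Fin n → Fin n → Fin r)
         (ε d : ℚ) (m : ℕ) (P : Fin (suc m) → Subset n) (G' : Graph n) : Set where
  field
    cover    : ∀ v → ∃[ i ] v ∈ P i
    disjoint : ∀ i j v → v ∈ P i → v ∈ P j → i ≡ j
    sub      : ∀ u v → adj G' u v ≡ true → adj G u v ≡ true
    offV₀    : ∀ u v → adj G' u v ≡ true → u ∉ P zero
    -- m ≥ 1/ε  (written ε·m ≥ 1, which also forces ε > 0)
    mBig     : 1ℚ ≤ ε * ℕ→ℚ m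
    V₀small  : ℕ→ℚ (card (P zero)) ≤ ε * ℕ→ℚ n
    equal    : ∀ (i j : Fin m) → card (P (suc i)) ≡ card (P (suc j))
    Vismall  : ∀ (i : Fin m) → ℕ→ℚ (card (P (suc i))) ≤ ε * ℕ→ℚ n
    degKeep  : ∀ v → v ∉ P zero →
               ℕ→ℚ (deg (adj G) v) - (ℕ→ℚ r * d + ε) * ℕ→ℚ n ≤ ℕ→ℚ (deg (adj G') v)
    noInside : ∀ (i : Fin m) u v → u ∈ P (suc i) → v ∈ P (suc i) → adj G' u v ≡ false
    regular  : ∀ (i j : Fin m) → i ≢ j → ∀ (k : Fin r) →
               IsRegular ε (colourAdj (adj G') c k) (P (suc i)) (P (suc j))
    dens     : ∀ (i j : Fin m) → i ≢ j → ∀ (k : Fin r) →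
               density (colourAdj (adj G') c k) (P (suc i)) (P (suc j)) ≡ 0ℚ
               ⊎ d ≤ density (colourAdj (adj G') c k) (P (suc i)) (P (suc j))

expSum : ℚ → ℕ → ℚ × ℚ
expSum a zero    = 1ℚ , 1ℚ
expSum a (suc K) = let (s , t) = expSum a K
                       t' = t * a * (+ 1 / suc K)
                   in (s + t') , t'

-- "x < e^a"  (for a > 0 the partial sums increase strictly to e^a)
LtExp : ℚ → ℚ → Set
LtExp x a = ∃[ K ] x < proj₁ (expSum a K)

-- The hypothesis  m·log n / √n < p  (natural logarithm), for p > 0, m ≥ 1:
-- equivalently there is a rational a > 0 with log n < a and a·m < p·√n,
-- i.e. n < e^a and (a·m)² < p²·n.
LogCondition : ℕ → ℕ → ℚ → Set
LogCondition n m p =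
  ∃[ a ] (0ℚ < a × (a * ℕ→ℚ m) * (a * ℕ→ℚ m) < p * p * ℕ→ℚ n × LtExp (ℕ→ℚ n) a)

{-# OPTIONS --safe #-}
module Submission where

-- Write p = P/Q and w = ⌊Q/10P⌋. Label every vertex by a uniform element of Fin (8w)
-- and let A be the vertices outside B labelled 0, so each of them is kept with
-- probability 1/8w ≈ 5p/4; probabilities become numbers of labellings. For a set S the
-- sum of α^|S ∩ A| · 2^|S ∖ A| over all labellings factorises, and Markov's inequality
-- with α = 1 and α = 3 gives Chernoff bounds: each way in which (a)–(d) can fail (|A| too
-- small or too large, |A ∩ V_i| too large, v with too few neighbours in A ∩ V_i or in A)
-- happens for at most a 2^-h fraction of the labellings. With log n < a and
-- (am)² < p²n, the number n is below (2 + 2A)·A^(2A) < 2^h for A = ⌊a⌋ + 1 and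
-- h = 4A² + 4A + 3, while h ≤ 8⌊a⌋² still fits into the Chernoff exponents. There are
-- at most 5nm events and 5nm < 2^h, so some labelling avoids all of them.

module Counting where

  open import Data.Bool using (Bool; true; false; _∧_; not)
  open import Data.Nat
  open import Data.Nat.Properties
  open import Data.Fin using (Fin; zero; suc)
  open import Data.Fin.Subset using (Subset; _∈_; _∩_; ∁; ⊤; ∣_∣)
  open import Data.Fin.Subset.Properties using (∣⊤∣≡n; ∩-identityˡ)
  open import Data.Vec using ([]; _∷_; lookup)
  import Data.Fin.Properties as Fin
  open import Data.Vec.Properties using ([]=⇒lookup; lookup⇒[]=; lookup-zipWith; lookup-map)
  open import Data.Product using (∃; _,_)
  open import Function using (_∘_)
  open import Relation.Binary.PropositionalEquality
  open import Relation.Nullary using (yes; no)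
  open import Algebra.Properties.CommutativeMonoid.Sum +-0-commutativeMonoid public
    using (sum; sum-syntax; sum-cong-≗; ∑-distrib-+; ∑-comm)
  open ≤-Reasoning

  ∑-mono : ∀ {k} {f g : Fin k → ℕ} → (∀ i → f i ≤ g i) → ∑[ i < k ] f i ≤ ∑[ i < k ] g i
  ∑-mono {zero}  f≤g = z≤n
  ∑-mono {suc k} f≤g = +-mono-≤ (f≤g zero) (∑-mono (f≤g ∘ suc))

  ∑-distribˡ-* : ∀ {k} c (f : Fin k → ℕ) → ∑[ i < k ] (c * f i) ≡ c * ∑[ i < k ] f i
  ∑-distribˡ-* {zero}  c f = sym (*-zeroʳ c)
  ∑-distribˡ-* {suc k} c f =
    trans (cong (c * f zero +_) (∑-distribˡ-* c (f ∘ suc))) (sym (*-distribˡ-+ c (f zero) _))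

  ∑-distribʳ-* : ∀ {k} c (f : Fin k → ℕ) → ∑[ i < k ] (f i * c) ≡ (∑[ i < k ] f i) * c
  ∑-distribʳ-* c f =
    trans (sum-cong-≗ (λ i → *-comm (f i) c)) (trans (∑-distribˡ-* c f) (*-comm c _))

  ∑-const : ∀ k c → ∑[ i < k ] c ≡ k * c
  ∑-const zero    c = refl
  ∑-const (suc k) c = cong (c +_) (∑-const k c)

  ∑-≤-const : ∀ {k c} {f : Fin k → ℕ} → (∀ i → f i ≤ c) → ∑[ i < k ] f i ≤ k * c
  ∑-≤-const {k} {c} f≤c = ≤-trans (∑-mono f≤c) (≤-reflexive (∑-const k c))

  ∑≡0⇒≡0 : ∀ {k} (f : Fin k → ℕ) → ∑[ i < k ] f i ≡ 0 → ∀ i → f i ≡ 0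
  ∑≡0⇒≡0 f ∑≡0 zero    = m+n≡0⇒m≡0 (f zero) ∑≡0
  ∑≡0⇒≡0 f ∑≡0 (suc i) = ∑≡0⇒≡0 (f ∘ suc) (m+n≡0⇒n≡0 (f zero) ∑≡0) i

  ∑<*⇒∃< : ∀ {k} c (f : Fin k → ℕ) → ∑[ i < k ] f i < k * c → ∃ λ i → f i < c
  ∑<*⇒∃< {suc k} c f ∑<kc with f zero <? c
  ... | yes f₀<c = zero , f₀<c
  ... | no  f₀≮c with ∑<*⇒∃< c (f ∘ suc) (+-cancelˡ-< c _ _ (≤-<-trans (+-monoˡ-≤ _ (≮⇒≥ f₀≮c)) ∑<kc))
  ...   | i , fᵢ<c = suc i , fᵢ<c

  𝟙 : Bool → ℕ
  𝟙 true  = 1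
  𝟙 false = 0

  ∣x∷p∣≡𝟙x+∣p∣ : ∀ {n} x (p : Subset n) → ∣ x ∷ p ∣ ≡ 𝟙 x + ∣ p ∣
  ∣x∷p∣≡𝟙x+∣p∣ true  p = refl
  ∣x∷p∣≡𝟙x+∣p∣ false p = refl

  ∣p∣≡∑𝟙 : ∀ {n} (p : Subset n) → ∣ p ∣ ≡ ∑[ u < n ] 𝟙 (lookup p u)
  ∣p∣≡∑𝟙 []      = refl
  ∣p∣≡∑𝟙 (x ∷ p) = trans (∣x∷p∣≡𝟙x+∣p∣ x p) (cong (𝟙 x +_) (∣p∣≡∑𝟙 p))

  ∣p∣≤∣q∣+∣r∣ : ∀ {n} (p q r : Subset n) →
    (∀ u → 𝟙 (lookup p u) ≤ 𝟙 (lookup q u) + 𝟙 (lookup r u)) → ∣ p ∣ ≤ ∣ q ∣ + ∣ r ∣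
  ∣p∣≤∣q∣+∣r∣ {n} p q r pointwise = begin
    ∣ p ∣                                                   ≡⟨ ∣p∣≡∑𝟙 p ⟩
    ∑[ u < n ] 𝟙 (lookup p u)                               ≤⟨ ∑-mono pointwise ⟩
    ∑[ u < n ] (𝟙 (lookup q u) + 𝟙 (lookup r u))            ≡⟨ ∑-distrib-+ {n} _ _ ⟩
    ∑[ u < n ] 𝟙 (lookup q u) + ∑[ u < n ] 𝟙 (lookup r u)   ≡⟨ sym (cong₂ _+_ (∣p∣≡∑𝟙 q) (∣p∣≡∑𝟙 r)) ⟩
    ∣ q ∣ + ∣ r ∣                                           ∎

  ∣p∩q∣≤∣∁r∩p∩q∣+∣r∩p∣ : ∀ {n} (p q r : Subset n) → ∣ p ∩ q ∣ ≤ ∣ ∁ r ∩ p ∩ q ∣ + ∣ r ∩ p ∣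
  ∣p∩q∣≤∣∁r∩p∩q∣+∣r∩p∣ p q r = ∣p∣≤∣q∣+∣r∣ (p ∩ q) (∁ r ∩ p ∩ q) (r ∩ p) pointwise
    where
    bits : ∀ x y z → 𝟙 (x ∧ y) ≤ 𝟙 (not z ∧ x ∧ y) + 𝟙 (z ∧ x)
    bits false y     z     = z≤n
    bits true  false z     = z≤n
    bits true  true  false = ≤-refl
    bits true  true  true  = ≤-refl
    pointwise : ∀ u → 𝟙 (lookup (p ∩ q) u) ≤ 𝟙 (lookup (∁ r ∩ p ∩ q) u) + 𝟙 (lookup (r ∩ p) u)
    pointwise u
      rewrite lookup-zipWith _∧_ u p q | lookup-zipWith _∧_ u (∁ r) (p ∩ q)
            | lookup-zipWith _∧_ u p q | lookup-map u not r | lookup-zipWith _∧_ u r p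
      = bits (lookup p u) (lookup q u) (lookup r u)

  ∑∣p∩Fᵢ∣≡∑∑𝟙 : ∀ {n k} (p : Subset n) (F : Fin k → Subset n) →
    ∑[ i < k ] ∣ p ∩ F i ∣ ≡ ∑[ u < n ] ∑[ i < k ] 𝟙 (lookup p u ∧ lookup (F i) u)
  ∑∣p∩Fᵢ∣≡∑∑𝟙 p F = trans
    (sum-cong-≗ λ i → trans (∣p∣≡∑𝟙 (p ∩ F i))
                            (sum-cong-≗ λ u → cong 𝟙 (lookup-zipWith _∧_ u p (F i))))
    (∑-comm (λ i u → 𝟙 (lookup p u ∧ lookup (F i) u)))

  1≤∑𝟙 : ∀ {k} (g : Fin k → Bool) → ∃ (λ i → g i ≡ true) → 1 ≤ ∑[ i < k ] 𝟙 (g i)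
  1≤∑𝟙 g (zero  , g₀≡true) rewrite g₀≡true = s≤s z≤n
  1≤∑𝟙 g (suc i , gᵢ≡true) = ≤-trans (1≤∑𝟙 (g ∘ suc) (i , gᵢ≡true)) (m≤n+m _ (𝟙 (g zero)))

  ∑𝟙≤1 : ∀ {k} (g : Fin k → Bool) → (∀ i j → g i ≡ true → g j ≡ true → i ≡ j) →
         ∑[ i < k ] 𝟙 (g i) ≤ 1
  ∑𝟙≤1 {zero}  g unique = z≤n
  ∑𝟙≤1 {suc k} g unique with g zero in g₀≡
  ... | false = ∑𝟙≤1 (g ∘ suc) (λ i j gᵢ gⱼ → Fin.suc-injective (unique (suc i) (suc j) gᵢ gⱼ))
  ... | true  = s≤s (≤-reflexive (trans (sum-cong-≗ rest≡0) (trans (∑-const k 0) (*-zeroʳ k))))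
    where
    rest≡0 : ∀ i → 𝟙 (g (suc i)) ≡ 0
    rest≡0 i with g (suc i) in gᵢ≡
    ... | false = refl
    ... | true  with () ← unique zero (suc i) g₀≡ gᵢ≡

  ∣p∣≤∑∣p∩Fᵢ∣ : ∀ {n k} (p : Subset n) (F : Fin k → Subset n) →
    (∀ u → u ∈ p → ∃ λ i → u ∈ F i) → ∣ p ∣ ≤ ∑[ i < k ] ∣ p ∩ F i ∣
  ∣p∣≤∑∣p∩Fᵢ∣ {n} {k} p F covered = begin
    ∣ p ∣                                                   ≡⟨ ∣p∣≡∑𝟙 p ⟩
    ∑[ u < n ] 𝟙 (lookup p u)                               ≤⟨ ∑-mono pointwise ⟩
    ∑[ u < n ] ∑[ i < k ] 𝟙 (lookup p u ∧ lookup (F i) u)   ≡⟨ sym (∑∣p∩Fᵢ∣≡∑∑𝟙 p F) ⟩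
    ∑[ i < k ] ∣ p ∩ F i ∣                                  ∎
    where
    pointwise : ∀ u → 𝟙 (lookup p u) ≤ ∑[ i < k ] 𝟙 (lookup p u ∧ lookup (F i) u)
    pointwise u with lookup p u in u∈p
    ... | false = z≤n
    ... | true  with covered u (lookup⇒[]= u p u∈p)
    ...   | i , u∈Fᵢ = 1≤∑𝟙 (λ i → lookup (F i) u) (i , []=⇒lookup u∈Fᵢ)

  ∑∣p∩Fᵢ∣≤∣p∣ : ∀ {n k} (p : Subset n) (F : Fin k → Subset n) →
    (∀ u i j → u ∈ F i → u ∈ F j → i ≡ j) → ∑[ i < k ] ∣ p ∩ F i ∣ ≤ ∣ p ∣
  ∑∣p∩Fᵢ∣≤∣p∣ {n} {k} p F disjoint = begin
    ∑[ i < k ] ∣ p ∩ F i ∣                                  ≡⟨ ∑∣p∩Fᵢ∣≡∑∑𝟙 p F ⟩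
    ∑[ u < n ] ∑[ i < k ] 𝟙 (lookup p u ∧ lookup (F i) u)   ≤⟨ ∑-mono pointwise ⟩
    ∑[ u < n ] 𝟙 (lookup p u)                               ≡⟨ sym (∣p∣≡∑𝟙 p) ⟩
    ∣ p ∣                                                   ∎
    where
    pointwise : ∀ u → ∑[ i < k ] 𝟙 (lookup p u ∧ lookup (F i) u) ≤ 𝟙 (lookup p u)
    pointwise u with lookup p u
    ... | false = ≤-trans (∑-≤-const {k} {0} (λ _ → z≤n)) (≤-reflexive (*-zeroʳ k))
    ... | true  = ∑𝟙≤1 (λ i → lookup (F i) u)
                    (λ i j uᵢ uⱼ → disjoint u i j (lookup⇒[]= u (F i) uᵢ) (lookup⇒[]= u (F j) uⱼ))

  ∣p∩q∣+∣p∩∁q∣≡∣p∣ : ∀ {n} (p q : Subset n) → ∣ p ∩ q ∣ + ∣ p ∩ ∁ q ∣ ≡ ∣ p ∣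
  ∣p∩q∣+∣p∩∁q∣≡∣p∣ []            []           = refl
  ∣p∩q∣+∣p∩∁q∣≡∣p∣ (false ∷ p) (y     ∷ q) = ∣p∩q∣+∣p∩∁q∣≡∣p∣ p q
  ∣p∩q∣+∣p∩∁q∣≡∣p∣ (true  ∷ p) (true  ∷ q) = cong suc (∣p∩q∣+∣p∩∁q∣≡∣p∣ p q)
  ∣p∩q∣+∣p∩∁q∣≡∣p∣ (true  ∷ p) (false ∷ q) = trans (+-suc _ _) (cong suc (∣p∩q∣+∣p∩∁q∣≡∣p∣ p q))

  n≤∑∣Fᵢ∣ : ∀ {n k} (F : Fin k → Subset n) → (∀ u → ∃ λ i → u ∈ F i) → n ≤ ∑[ i < k ] ∣ F i ∣
  n≤∑∣Fᵢ∣ {n} F covered = subst₂ _≤_ (∣⊤∣≡n n) (sum-cong-≗ (λ i → cong ∣_∣ (∩-identityˡ (F i))))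
    (∣p∣≤∑∣p∩Fᵢ∣ ⊤ F (λ u _ → covered u))

  ∑∣Fᵢ∣≤n : ∀ {n k} (F : Fin k → Subset n) →
    (∀ u i j → u ∈ F i → u ∈ F j → i ≡ j) → ∑[ i < k ] ∣ F i ∣ ≤ n
  ∑∣Fᵢ∣≤n {n} F disjoint = subst₂ _≤_ (sum-cong-≗ (λ i → cong ∣_∣ (∩-identityˡ (F i)))) (∣⊤∣≡n n)
    (∑∣p∩Fᵢ∣≤∣p∣ ⊤ F disjoint)

module Fractions where

  open import Data.Nat as ℕ using (ℕ; suc; zero)
  import Data.Nat.Properties as ℕ
  open import Data.Integer as ℤ using (+_; -[1+_])
  import Data.Integer.Properties as ℤ
  open import Data.Rational as ℚ using (ℚ; mkℚ; toℚᵘ; 0ℚ; 1ℚ; _*_; _+_; _≤_; _<_)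
  import Data.Rational.Properties as ℚ
  open import Data.Rational.Unnormalised as ℚᵘ using (mkℚᵘ; *≡*; *≤*; *<*; _≃_)
  import Data.Rational.Unnormalised.Properties as ℚᵘ
  open import Data.Product using (∃₂; _,_)
  open import Data.Empty using (⊥-elim)
  open import Relation.Binary.PropositionalEquality
  open import Defs using (ℕ→ℚ)

  infix 4 _≐_÷_

  -- x ≐ u ÷ d says x = u/d. The unnormalised rational stores d − 1, so only d ≥ 1 is
  -- meaningful and every lemma takes denominators of the form suc b.

  _≐_÷_ : ℚ → ℕ → ℕ → Set
  x ≐ u ÷ d = toℚᵘ x ≃ mkℚᵘ (+ u) (ℕ.pred d)

  +[u]/d≐u÷d : ∀ u d → + u ℚ./ suc d ≐ u ÷ suc d
  +[u]/d≐u÷d u d = ℚ.toℚᵘ-fromℚᵘ (mkℚᵘ (+ u) d)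

  ℕ→ℚ≐÷1 : ∀ k → ℕ→ℚ k ≐ k ÷ 1
  ℕ→ℚ≐÷1 k = +[u]/d≐u÷d k 0

  private
    +*+ : ∀ a b → + a ℤ.* + b ≡ + (a ℕ.* b)
    +*+ a b = sym (ℤ.pos-* a b)

  ≐-* : ∀ {x y a b c d} → x ≐ a ÷ suc b → y ≐ c ÷ suc d → x * y ≐ a ℕ.* c ÷ suc b ℕ.* suc d
  ≐-* {x} {y} {a} {b} {c} {d} x≐ y≐ = ℚᵘ.≃-trans (ℚ.toℚᵘ-homo-* x y)
    (ℚᵘ.≃-trans (ℚᵘ.*-cong x≐ y≐) (*≡* (cong (ℤ._* + (suc b ℕ.* suc d)) (+*+ a c))))

  ≐-+ : ∀ {x y a b c d} → x ≐ a ÷ suc b → y ≐ c ÷ suc d →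
        x + y ≐ a ℕ.* suc d ℕ.+ c ℕ.* suc b ÷ suc b ℕ.* suc d
  ≐-+ {x} {y} {a} {b} {c} {d} x≐ y≐ = ℚᵘ.≃-trans (ℚ.toℚᵘ-homo-+ x y)
    (ℚᵘ.≃-trans (ℚᵘ.+-cong x≐ y≐)
      (*≡* (cong (ℤ._* + (suc b ℕ.* suc d)) (cong₂ ℤ._+_ (+*+ a (suc d)) (+*+ c (suc b))))))

  ≐-cross : ∀ {x a b c d} → x ≐ a ÷ suc b → a ℕ.* suc d ≡ c ℕ.* suc b → x ≐ c ÷ suc d
  ≐-cross {x} {a} {b} {c} {d} x≐ eq =
    ℚᵘ.≃-trans x≐ (*≡* (trans (+*+ a (suc d)) (trans (cong +_ eq) (sym (+*+ c (suc b))))))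

  ≐-≤⇒ : ∀ {x y a b c d} → x ≐ a ÷ suc b → y ≐ c ÷ suc d → x ≤ y → a ℕ.* suc d ℕ.≤ c ℕ.* suc b
  ≐-≤⇒ {x} {y} {a} {b} {c} {d} x≐ y≐ x≤y
    with ℚᵘ.≤-respʳ-≃ y≐ (ℚᵘ.≤-respˡ-≃ x≐ (ℚ.toℚᵘ-mono-≤ x≤y))
  ... | *≤* le = ℤ.drop‿+≤+ (subst₂ ℤ._≤_ (+*+ a (suc d)) (+*+ c (suc b)) le)

  ≐-≤⇐ : ∀ {x y a b c d} → x ≐ a ÷ suc b → y ≐ c ÷ suc d → a ℕ.* suc d ℕ.≤ c ℕ.* suc b → x ≤ y
  ≐-≤⇐ {x} {y} {a} {b} {c} {d} x≐ y≐ le =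
    ℚ.toℚᵘ-cancel-≤ (ℚᵘ.≤-respʳ-≃ (ℚᵘ.≃-sym y≐) (ℚᵘ.≤-respˡ-≃ (ℚᵘ.≃-sym x≐)
      (*≤* (subst₂ ℤ._≤_ (sym (+*+ a (suc d))) (sym (+*+ c (suc b))) (ℤ.+≤+ le)))))

  ≐-<⇒ : ∀ {x y a b c d} → x ≐ a ÷ suc b → y ≐ c ÷ suc d → x < y → a ℕ.* suc d ℕ.< c ℕ.* suc b
  ≐-<⇒ {x} {y} {a} {b} {c} {d} x≐ y≐ x<y
    with ℚᵘ.<-respʳ-≃ y≐ (ℚᵘ.<-respˡ-≃ x≐ (ℚ.toℚᵘ-mono-< x<y))
  ... | *<* lt = ℤ.drop‿+<+ (subst₂ ℤ._<_ (+*+ a (suc d)) (+*+ c (suc b)) lt)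

  positive⇒≐ : ∀ x → 0ℚ < x → ∃₂ λ u v → x ≐ suc u ÷ suc v
  positive⇒≐ (mkℚ (+ zero)  v _) (ℚ.*<* (ℤ.+<+ ()))
  positive⇒≐ (mkℚ (+ suc u) v _) _ = u , v , ℚᵘ.≃-refl
  positive⇒≐ (mkℚ -[1+ u ]  v _) (ℚ.*<* ())

  1≤x*k⇒≐ : ∀ x k → 1ℚ ≤ x * ℕ→ℚ k → ∃₂ λ u v → x ≐ u ÷ suc v
  1≤x*k⇒≐ (mkℚ (+ u)     v _) k _ = u , v , ℚᵘ.≃-refl
  1≤x*k⇒≐ x@(mkℚ -[1+ u ] v _) k 1≤x*k = ⊥-elim (ℚ.<-irrefl refl (ℚ.≤-<-trans 1≤x*k x*k<1))
    where
    0≤k : 0ℚ ≤ ℕ→ℚ k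
    0≤k = ≐-≤⇐ (ℕ→ℚ≐÷1 0) (ℕ→ℚ≐÷1 k) ℕ.z≤n
    x*k<1 : x * ℕ→ℚ k < 1ℚ
    x*k<1 = ℚ.≤-<-trans
      (ℚ.nonPositive⁻¹ (x * ℕ→ℚ k)
         {{ℚ.nonPos*nonNeg⇒nonPos x {{ℚ.neg⇒nonPos x}} (ℕ→ℚ k) {{ℚ.nonNegative 0≤k}}}})
      (ℚ.*<* (ℤ.+<+ (ℕ.s≤s ℕ.z≤n)))

module ExponentialSeries where

  open import Data.Nat
  open import Data.Nat.Properties
  open import Data.Rational as ℚ using (ℚ)
  open import Data.Product using (proj₁; proj₂)
  open import Relation.Binary.PropositionalEquality
  open import Relation.Nullary using (yes; no)
  open import Data.Nat.Tactic.RingSolver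
  open import Defs using (expSum; ℕ→ℚ)
  open Fractions
  open ≤-Reasoning

  expBound : ℕ → ℕ
  expBound A = (2 + 2 * A) * A ^ (2 * A)

  -- At a = N/D ≤ A the K-th term T and partial sum S of the exponential series satisfy
  -- T ≤ A^K and S ≤ (K+1) A^K; once K ≥ 2A each new term is at most half the previous
  -- one, so S + T stops growing.
  module _ {a : ℚ} {N D′ : ℕ} (a≐ : a ≐ N ÷ suc D′) (A : ℕ) .{{_ : NonZero A}}
           (N≤AD : N ≤ A * suc D′) where

    private
      D = suc D′

    record PartialSumBound (K : ℕ) : Set where
      field
        v S T : ℕ
        S≐ : proj₁ (expSum a K) ≐ S ÷ suc v
        T≐ : proj₂ (expSum a K) ≐ T ÷ suc v
        T≤ : T ≤ A ^ K * suc v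
        S≤ : S ≤ suc K * A ^ K * suc v
        S+T≤ : S + T ≤ expBound A * suc v

    private
      2≤expBound : 2 ≤ expBound A
      2≤expBound = *-mono-≤ {2} {2 + 2 * A} {1} (m≤m+n 2 _) (m^n>0 A (2 * A))

      bound₀ : PartialSumBound 0
      bound₀ = record
        { v = 0 ; S = 1 ; T = 1 ; S≐ = ℕ→ℚ≐÷1 1 ; T≐ = ℕ→ℚ≐÷1 1 ; T≤ = ≤-refl ; S≤ = ≤-refl
        ; S+T≤ = subst (2 ≤_) (sym (*-identityʳ (expBound A))) 2≤expBound }

      module Step {K} (I : PartialSumBound K) where
        open PartialSumBound I

        den = suc v * D * suc K
        T′ = T * N
        S′ = S * (D * suc K) + T * N

        T′≐ : proj₂ (expSum a (suc K)) ≐ T′ ÷ den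
        T′≐ = subst (λ t → proj₂ (expSum a (suc K)) ≐ t ÷ den) (*-identityʳ T′)
            (≐-* (≐-* T≐ a≐) (+[u]/d≐u÷d 1 K))

        S′≐ : proj₁ (expSum a (suc K)) ≐ S′ ÷ den
        S′≐ = ≐-cross (≐-+ S≐ T′≐) (cross S T N v D′ K)
          where
          cross : ∀ S T N v D′ K →
            (S * ((1 + v) * (1 + D′) * (1 + K)) + T * N * (1 + v)) * ((1 + v) * (1 + D′) * (1 + K))
              ≡ (S * ((1 + D′) * (1 + K)) + T * N) * ((1 + v) * ((1 + v) * (1 + D′) * (1 + K)))
          cross = solve-∀

        T′≤ : T′ ≤ A ^ suc K * den
        T′≤ = begin
          T * N                           ≤⟨ *-mono-≤ T≤ N≤AD ⟩
          A ^ K * suc v * (A * D)         ≡⟨ regroup (A ^ K) (suc v) A D ⟩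
          A * A ^ K * (suc v * D) * 1     ≤⟨ *-monoʳ-≤ (A * A ^ K * (suc v * D)) (s≤s z≤n) ⟩
          A * A ^ K * (suc v * D) * suc K ≡⟨ *-assoc (A * A ^ K) (suc v * D) (suc K) ⟩
          A ^ suc K * den                 ∎
          where
          regroup : ∀ x s a d → x * s * (a * d) ≡ a * x * (s * d) * 1
          regroup = solve-∀

        S′≤ : S′ ≤ suc (suc K) * A ^ suc K * den
        S′≤ = begin
          S * (D * suc K) + T * N
            ≤⟨ +-mono-≤ (*-monoˡ-≤ (D * suc K) S≤) T′≤ ⟩
          suc K * A ^ K * suc v * (D * suc K) + A ^ suc K * den
            ≤⟨ +-monoˡ-≤ (A ^ suc K * den)
                 (*-monoˡ-≤ (D * suc K) (*-monoˡ-≤ (suc v) (*-monoʳ-≤ (suc K) A^K≤A^1+K))) ⟩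
          suc K * A ^ suc K * suc v * (D * suc K) + A ^ suc K * den
            ≡⟨ collect K (A ^ suc K) (suc v) D ⟩
          suc (suc K) * A ^ suc K * den ∎
          where
          A^K≤A^1+K : A ^ K ≤ A ^ suc K
          A^K≤A^1+K = ^-monoʳ-≤ A (n≤1+n K)
          collect : ∀ K y s d → (1 + K) * y * s * (d * (1 + K)) + y * (s * d * (1 + K))
                            ≡ (2 + K) * y * (s * d * (1 + K))
          collect = solve-∀

        S′+T′≤ : S′ + T′ ≤ expBound A * den
        S′+T′≤ with suc K ≤? 2 * A
        ... | yes 1+K≤2A = begin
          S′ + T′                                          ≤⟨ +-mono-≤ S′≤ T′≤ ⟩
          suc (suc K) * A ^ suc K * den + A ^ suc K * den  ≡⟨ collect K (A ^ suc K) den ⟩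
          (3 + K) * A ^ suc K * den
            ≤⟨ *-monoˡ-≤ den (*-mono-≤ (+-monoʳ-≤ 2 1+K≤2A) (^-monoʳ-≤ A 1+K≤2A)) ⟩
          expBound A * den ∎
          where
          collect : ∀ K x s → (2 + K) * x * s + x * s ≡ (3 + K) * x * s
          collect = solve-∀
        ... | no 1+K≰2A = begin
          S * (D * suc K) + T * N + T * N        ≡⟨ double S (D * suc K) T N ⟩
          S * (D * suc K) + T * (2 * N)          ≤⟨ +-monoʳ-≤ (S * (D * suc K)) (*-monoʳ-≤ T 2N≤D[1+K]) ⟩
          S * (D * suc K) + T * (D * suc K)      ≡⟨ *-distribʳ-+ (D * suc K) S T ⟨
          (S + T) * (D * suc K)                  ≤⟨ *-monoˡ-≤ (D * suc K) S+T≤ ⟩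
          expBound A * suc v * (D * suc K)       ≡⟨ *-assoc (expBound A) (suc v) (D * suc K) ⟩
          expBound A * (suc v * (D * suc K))     ≡⟨ cong (expBound A *_) (*-assoc (suc v) D (suc K)) ⟨
          expBound A * den                       ∎
          where
          double : ∀ s x t n → s * x + t * n + t * n ≡ s * x + t * (2 * n)
          double = solve-∀
          2N≤D[1+K] : 2 * N ≤ D * suc K
          2N≤D[1+K] = begin
            2 * N        ≤⟨ *-monoʳ-≤ 2 N≤AD ⟩
            2 * (A * D)  ≡⟨ *-assoc 2 A D ⟨
            2 * A * D    ≤⟨ *-monoˡ-≤ D (≤-trans (≮⇒≥ 1+K≰2A) (n≤1+n K)) ⟩
            suc K * D    ≡⟨ *-comm (suc K) D ⟩
            D * suc K    ∎

      step : ∀ {K} → PartialSumBound K → PartialSumBound (suc K)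
      step I = record { v = pred den ; S = S′ ; T = T′ ; S≐ = S′≐ ; T≐ = T′≐
                      ; T≤ = T′≤ ; S≤ = S′≤ ; S+T≤ = S′+T′≤ }
        where open Step I

    partialSumBound : ∀ K → PartialSumBound K
    partialSumBound zero    = bound₀
    partialSumBound (suc K) = step (partialSumBound K)

    <expSum⇒<expBound : ∀ n K → ℕ→ℚ n ℚ.< proj₁ (expSum a K) → n < expBound A
    <expSum⇒<expBound n K n<S = *-cancelʳ-< _ n (expBound A) (begin-strict
      n * suc v  <⟨ subst (n * suc v <_) (*-identityʳ S) (≐-<⇒ (ℕ→ℚ≐÷1 n) S≐ n<S) ⟩
      S          ≤⟨ m≤m+n S T ⟩
      S + T      ≤⟨ S+T≤ ⟩
      expBound A * suc v ∎)
      where open PartialSumBound (partialSumBound K)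

module PowerEstimates where

  open import Data.Nat
  open import Data.Nat.Properties
  open import Data.List using ([]; _∷_)
  open import Relation.Binary.PropositionalEquality
  open import Data.Nat.Tactic.RingSolver
  open import Data.Unit using (tt)
  open import Algebra.Properties.CommutativeSemigroup *-commutativeSemigroup
    using (interchange; xy∙z≈x∙zy; x∙yz≈y∙zx; x∙yz≈yx∙z)
  open ≤-Reasoning

  ^-distrib-* : ∀ a b o → (a * b) ^ o ≡ a ^ o * b ^ o
  ^-distrib-* a b zero    = refl
  ^-distrib-* a b (suc o) = begin-equality
    a * b * (a * b) ^ o       ≡⟨ cong (a * b *_) (^-distrib-* a b o) ⟩
    a * b * (a ^ o * b ^ o)   ≡⟨ interchange a b (a ^ o) (b ^ o) ⟩
    a * a ^ o * (b * b ^ o)   ∎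

  ^-*-split : ∀ a w j r → a ^ (w * j + r) ≡ (a ^ w) ^ j * a ^ r
  ^-*-split a w j r = trans (^-distribˡ-+-* a (w * j) r) (cong (_* a ^ r) (sym (^-*-assoc a w j)))

  N^w*[N+w]≤N*[1+N]^w : ∀ N w → N ^ w * (N + w) ≤ N * suc N ^ w
  N^w*[N+w]≤N*[1+N]^w N zero    = ≤-reflexive (solve (N ∷ []))
  N^w*[N+w]≤N*[1+N]^w N (suc w) = begin
    N * N ^ w * (N + suc w)           ≡⟨ expand N (N ^ w) w ⟩
    N * (N ^ w * (N + w) + N ^ w)     ≤⟨ *-monoʳ-≤ N (+-mono-≤ (N^w*[N+w]≤N*[1+N]^w N w)
                                                              (^-monoˡ-≤ w (n≤1+n N))) ⟩
    N * (N * suc N ^ w + suc N ^ w)   ≡⟨ cong (N *_) (+-comm (N * suc N ^ w) (suc N ^ w)) ⟩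
    N * (suc N * suc N ^ w)           ∎
    where
    expand : ∀ N x w → N * x * (N + suc w) ≡ N * (x * (N + w) + x)
    expand = solve-∀

  [1+M]^[1+w]≤[1+M]*M^w+w*[1+M]^w : ∀ M w → suc M ^ suc w ≤ suc M * M ^ w + w * suc M ^ w
  [1+M]^[1+w]≤[1+M]*M^w+w*[1+M]^w M zero    = ≤-reflexive (sym (+-identityʳ _))
  [1+M]^[1+w]≤[1+M]*M^w+w*[1+M]^w M (suc w) = begin
    suc M * suc M ^ suc w
      ≡⟨⟩
    suc M ^ suc w + M * suc M ^ suc w
      ≤⟨ +-monoʳ-≤ (suc M ^ suc w) (*-monoʳ-≤ M ([1+M]^[1+w]≤[1+M]*M^w+w*[1+M]^w M w)) ⟩
    suc M ^ suc w + M * (suc M * M ^ w + w * X)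
      ≡⟨ regroup M (M ^ w) X w ⟩
    suc M * (M * M ^ w) + (X + M * w * X + M * X)
      ≤⟨ +-monoʳ-≤ (suc M * (M * M ^ w)) (+-monoˡ-≤ (M * X) (+-monoʳ-≤ X (*-monoˡ-≤ X Mw≤w[1+M]))) ⟩
    suc M * (M * M ^ w) + (X + w * suc M * X + M * X)
      ≡⟨ cong (suc M * (M * M ^ w) +_) (collect M w X) ⟩
    suc M * (M * M ^ w) + suc w * (suc M * X) ∎
    where
    X = suc M ^ w
    Mw≤w[1+M] : M * w ≤ w * suc M
    Mw≤w[1+M] = ≤-trans (≤-reflexive (*-comm M w)) (*-monoʳ-≤ w (n≤1+n M))
    regroup : ∀ M y X w → (1 + M) * X + M * ((1 + M) * y + w * X)
                        ≡ (1 + M) * (M * y) + (X + M * w * X + M * X)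
    regroup = solve-∀
    collect : ∀ M w X → X + w * (1 + M) * X + M * X ≡ (1 + w) * ((1 + M) * X)
    collect = solve-∀

  [2+M]^w*M^w≤[1+M]^w*[1+M]^w : ∀ M w → suc (suc M) ^ w * M ^ w ≤ suc M ^ w * suc M ^ w
  [2+M]^w*M^w≤[1+M]^w*[1+M]^w M w = begin
    suc (suc M) ^ w * M ^ w  ≡⟨ ^-distrib-* (suc (suc M)) M w ⟨
    (suc (suc M) * M) ^ w    ≤⟨ ^-monoˡ-≤ w (≤-trans (n≤1+n _) (≤-reflexive (square M))) ⟩
    (suc M * suc M) ^ w      ≡⟨ ^-distrib-* (suc M) (suc M) w ⟩
    suc M ^ w * suc M ^ w    ∎
    where
    square : ∀ M → 1 + (2 + M) * M ≡ (1 + M) * (1 + M)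
    square = solve-∀

  -- With M = 16w − 1: M^w (M + 1 + w) ≤ (M + 1)^(w+1) by Bernoulli's inequality and
  -- (M + 2) M ≤ (M + 1)², that is (1 − 1/16w)^w ≤ 16w/17w.
  17*[16w-1]^w≤16*[16w]^w : ∀ w′ → 17 * (15 + 16 * w′) ^ suc w′ ≤ 16 * (16 + 16 * w′) ^ suc w′
  17*[16w-1]^w≤16*[16w]^w w′ = *-cancelʳ-≤ (17 * Y) (16 * X) w (begin
    17 * Y * w                ≡⟨ lhs Y w′ ⟩
    Y * (suc M + w)           ≤⟨ *-cancelʳ-≤ _ _ X {{m^n≢0 (suc M) w}} (begin
      Y * (suc M + w) * X                    ≡⟨ xy∙z≈x∙zy Y (suc M + w) X ⟩
      Y * (X * (suc M + w))                  ≤⟨ *-monoʳ-≤ Y (N^w*[N+w]≤N*[1+N]^w (suc M) w) ⟩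
      Y * (suc M * suc (suc M) ^ w)          ≡⟨ x∙yz≈y∙zx Y (suc M) (suc (suc M) ^ w) ⟩
      suc M * (suc (suc M) ^ w * Y)          ≤⟨ *-monoʳ-≤ (suc M) ([2+M]^w*M^w≤[1+M]^w*[1+M]^w M w) ⟩
      suc M * (X * X)                        ≡⟨ *-assoc (suc M) X X ⟨
      suc M * X * X                          ∎) ⟩
    suc M * X                 ≡⟨ rhs X w′ ⟩
    16 * X * w                ∎)
    where
    w = suc w′
    M = 15 + 16 * w′
    X = suc M ^ w
    Y = M ^ w
    lhs : ∀ y w′ → 17 * y * (1 + w′) ≡ y * ((16 + 16 * w′) + (1 + w′))
    lhs = solve-∀
    rhs : ∀ x w′ → (16 + 16 * w′) * x ≡ 16 * x * (1 + w′)
    rhs = solve-∀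

  15*[16w+1]^w≤16*[16w]^w : ∀ w′ → 15 * (17 + 16 * w′) ^ suc w′ ≤ 16 * (16 + 16 * w′) ^ suc w′
  15*[16w+1]^w≤16*[16w]^w w′ = *-cancelʳ-≤ (15 * Y) (16 * X) w (+-cancelʳ-≤ (w * Y) _ _ (begin
    15 * Y * w + w * Y        ≡⟨ lhs Y w′ ⟩
    suc M * Y                 ≤⟨ *-cancelˡ-≤ X {{m^n≢0 (suc M) w}} (begin
      X * (suc M * Y)                        ≡⟨ x∙yz≈yx∙z X (suc M) Y ⟩
      suc M ^ suc w * Y                      ≤⟨ *-monoˡ-≤ Y ([1+M]^[1+w]≤[1+M]*M^w+w*[1+M]^w M w) ⟩
      (suc M * M ^ w + w * X) * Y            ≡⟨ distribute (suc M) (M ^ w) w X Y ⟩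
      suc M * (Y * M ^ w) + w * X * Y        ≤⟨ +-monoˡ-≤ (w * X * Y)
                                                  (*-monoʳ-≤ (suc M) ([2+M]^w*M^w≤[1+M]^w*[1+M]^w M w)) ⟩
      suc M * (X * X) + w * X * Y            ≡⟨ factor (suc M) w X Y ⟩
      X * (suc M * X + w * Y)                ∎) ⟩
    suc M * X + w * Y         ≡⟨ rhs X Y w′ ⟩
    16 * X * w + w * Y        ∎))
    where
    w = suc w′
    M = 15 + 16 * w′
    X = suc M ^ w
    Y = suc (suc M) ^ w
    lhs : ∀ y w′ → 15 * y * (1 + w′) + (1 + w′) * y ≡ (16 + 16 * w′) * y
    lhs = solve-∀
    rhs : ∀ x y w′ → (16 + 16 * w′) * x + (1 + w′) * y ≡ 16 * x * (1 + w′) + (1 + w′) * y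
    rhs = solve-∀
    distribute : ∀ a z w x y → (a * z + w * x) * y ≡ a * (y * z) + w * x * y
    distribute = solve-∀
    factor : ∀ a w x y → a * (x * x) + w * x * y ≡ x * (a * x + w * y)
    factor = solve-∀

  2^e*16^[12e]≤17^[12e] : ∀ e → 2 ^ e * 16 ^ (12 * e) ≤ 17 ^ (12 * e)
  2^e*16^[12e]≤17^[12e] e = begin
    2 ^ e * 16 ^ (12 * e)   ≡⟨ cong (2 ^ e *_) (^-*-assoc 16 12 e) ⟨
    2 ^ e * (16 ^ 12) ^ e   ≡⟨ ^-distrib-* 2 (16 ^ 12) e ⟨
    (2 * 16 ^ 12) ^ e       ≤⟨ ^-monoˡ-≤ e (≤ᵇ⇒≤ (2 * 16 ^ 12) (17 ^ 12) tt) ⟩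
    (17 ^ 12) ^ e           ≡⟨ ^-*-assoc 17 12 e ⟩
    17 ^ (12 * e)           ∎

  -- Since (16/17)^12 ≤ 1/2, every block of 12w factors (16w−1)/16w halves the product.
  2^k*2^h*[16w-1]^D≤[16w]^D : ∀ w′ k h D → 12 * (k + h) * suc w′ ≤ D →
    2 ^ k * 2 ^ h * (15 + 16 * w′) ^ D ≤ (16 + 16 * w′) ^ D
  2^k*2^h*[16w-1]^D≤[16w]^D w′ k h D D≥ = *-cancelˡ-≤ (17 ^ j) {{m^n≢0 17 j}} (begin
    17 ^ j * (2 ^ k * 2 ^ h * M ^ D)
      ≡⟨ cong₂ (λ x y → 17 ^ j * (x * y)) (^-distribˡ-+-* 2 k h) (sym (split M)) ⟨
    17 ^ j * (2 ^ (k + h) * ((M ^ w) ^ j * M ^ r))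
      ≡⟨ shuffle (17 ^ j) (2 ^ (k + h)) ((M ^ w) ^ j) (M ^ r) ⟩
    2 ^ (k + h) * (17 ^ j * (M ^ w) ^ j) * M ^ r
      ≤⟨ *-mono-≤ (*-monoʳ-≤ (2 ^ (k + h)) blocks) (^-monoˡ-≤ r (n≤1+n M)) ⟩
    2 ^ (k + h) * (16 ^ j * (N ^ w) ^ j) * N ^ r
      ≡⟨ regroup (2 ^ (k + h)) (16 ^ j) ((N ^ w) ^ j) (N ^ r) ⟩
    2 ^ (k + h) * 16 ^ j * ((N ^ w) ^ j * N ^ r)
      ≤⟨ *-monoˡ-≤ _ (2^e*16^[12e]≤17^[12e] (k + h)) ⟩
    17 ^ j * ((N ^ w) ^ j * N ^ r)
      ≡⟨ cong (17 ^ j *_) (split N) ⟨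
    17 ^ j * N ^ D ∎)
    where
    w = suc w′
    j = 12 * (k + h)
    M = 15 + 16 * w′
    N = 16 + 16 * w′
    r = D ∸ w * j
    split : ∀ a → a ^ D ≡ (a ^ w) ^ j * a ^ r
    split a = trans (cong (a ^_) (sym (m+[n∸m]≡n (subst (_≤ D) (*-comm j w) D≥)))) (^-*-split a w j r)
    blocks : 17 ^ j * (M ^ w) ^ j ≤ 16 ^ j * (N ^ w) ^ j
    blocks = begin
      17 ^ j * (M ^ w) ^ j   ≡⟨ ^-distrib-* 17 (M ^ w) j ⟨
      (17 * M ^ w) ^ j       ≤⟨ ^-monoˡ-≤ j (17*[16w-1]^w≤16*[16w]^w w′) ⟩
      (16 * N ^ w) ^ j       ≡⟨ ^-distrib-* 16 (N ^ w) j ⟩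
      16 ^ j * (N ^ w) ^ j   ∎
    shuffle : ∀ a b c d → a * (b * (c * d)) ≡ b * (a * c) * d
    shuffle = solve-∀
    regroup : ∀ a b c d → a * (b * c) * d ≡ a * b * (c * d)
    regroup = solve-∀

  2^h*[2*16^6]^k≤[3*15^6]^k : ∀ k h → 55 * h ≤ k → 2 ^ h * (2 * 16 ^ 6) ^ k ≤ (3 * 15 ^ 6) ^ k
  2^h*[2*16^6]^k≤[3*15^6]^k k h 55h≤k = begin
    2 ^ h * c₁ ^ k                      ≡⟨ cong (λ x → 2 ^ h * c₁ ^ x) k≡ ⟨
    2 ^ h * c₁ ^ (55 * h + e)           ≡⟨ cong (2 ^ h *_) (^-distribˡ-+-* c₁ (55 * h) e) ⟩
    2 ^ h * (c₁ ^ (55 * h) * c₁ ^ e)    ≡⟨ *-assoc (2 ^ h) _ _ ⟨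
    2 ^ h * c₁ ^ (55 * h) * c₁ ^ e      ≤⟨ *-mono-≤ head (^-monoˡ-≤ e (≤ᵇ⇒≤ c₁ c₂ tt)) ⟩
    c₂ ^ (55 * h) * c₂ ^ e              ≡⟨ ^-distribˡ-+-* c₂ (55 * h) e ⟨
    c₂ ^ (55 * h + e)                   ≡⟨ cong (c₂ ^_) k≡ ⟩
    c₂ ^ k                              ∎
    where
    c₁ = 2 * 16 ^ 6
    c₂ = 3 * 15 ^ 6
    e = k ∸ 55 * h
    k≡ : 55 * h + e ≡ k
    k≡ = m+[n∸m]≡n 55h≤k
    ^55h : ∀ c → c ^ (55 * h) ≡ (c ^ 55) ^ h
    ^55h c = sym (^-*-assoc c 55 h)
    head : 2 ^ h * c₁ ^ (55 * h) ≤ c₂ ^ (55 * h)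
    head = begin
      2 ^ h * c₁ ^ (55 * h)   ≡⟨ cong (2 ^ h *_) (^55h c₁) ⟩
      2 ^ h * (c₁ ^ 55) ^ h   ≡⟨ ^-distrib-* 2 (c₁ ^ 55) h ⟨
      (2 * c₁ ^ 55) ^ h       ≤⟨ ^-monoˡ-≤ h (≤ᵇ⇒≤ (2 * c₁ ^ 55) (c₂ ^ 55) tt) ⟩
      (c₂ ^ 55) ^ h           ≡⟨ ^55h c₂ ⟨
      c₂ ^ (55 * h)           ∎

  -- Each block of w factors (16w+1)/16w is at most 16/15, and 2 · (16/15)^6 < 3 leaves
  -- enough slack to absorb 2^h once k ≥ 55h.
  2^k*2^h*[16w+1]^D≤3^k*[16w]^D : ∀ w′ k h D j → D ≤ j * suc w′ → j ≤ 6 * k → 55 * h ≤ k →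
    2 ^ k * 2 ^ h * (17 + 16 * w′) ^ D ≤ 3 ^ k * (16 + 16 * w′) ^ D
  2^k*2^h*[16w+1]^D≤3^k*[16w]^D w′ k h D j D≤jw j≤6k 55h≤k =
    *-cancelˡ-≤ (15 ^ (6 * k) * N ^ r) {{m*n≢0 _ _ {{m^n≢0 15 (6 * k)}} {{m^n≢0 N r}}}} (begin
      15 ^ (6 * k) * N ^ r * (K * Y ^ D)
        ≡⟨ cong (λ x → x * N ^ r * (K * Y ^ D)) (split 15) ⟩
      15 ^ j * 15 ^ e * N ^ r * (K * Y ^ D)
        ≡⟨ shuffle₁ (15 ^ j) (15 ^ e) (N ^ r) K (Y ^ D) ⟩
      K * 15 ^ e * (15 ^ j * (Y ^ D * N ^ r))
        ≤⟨ *-monoʳ-≤ (K * 15 ^ e) (*-monoʳ-≤ (15 ^ j) (*-monoʳ-≤ (Y ^ D) (^-monoˡ-≤ r (n≤1+n N)))) ⟩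
      K * 15 ^ e * (15 ^ j * (Y ^ D * Y ^ r))
        ≡⟨ cong (λ x → K * 15 ^ e * (15 ^ j * x)) (fill Y) ⟩
      K * 15 ^ e * (15 ^ j * (Y ^ w) ^ j)
        ≤⟨ *-monoʳ-≤ (K * 15 ^ e) blocks ⟩
      K * 15 ^ e * (16 ^ j * (N ^ w) ^ j)
        ≤⟨ *-monoˡ-≤ (16 ^ j * (N ^ w) ^ j) (*-monoʳ-≤ K (^-monoˡ-≤ e (n≤1+n 15))) ⟩
      K * 16 ^ e * (16 ^ j * (N ^ w) ^ j)
        ≡⟨ shuffle₂ (2 ^ k) (2 ^ h) (16 ^ e) (16 ^ j) ((N ^ w) ^ j) ⟩
      2 ^ h * (2 ^ k * (16 ^ j * 16 ^ e)) * (N ^ w) ^ j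
        ≡⟨ cong (λ x → 2 ^ h * (2 ^ k * x) * (N ^ w) ^ j) (split 16) ⟨
      2 ^ h * (2 ^ k * 16 ^ (6 * k)) * (N ^ w) ^ j
        ≤⟨ *-monoˡ-≤ ((N ^ w) ^ j) constants ⟩
      3 ^ k * 15 ^ (6 * k) * (N ^ w) ^ j
        ≡⟨ cong (3 ^ k * 15 ^ (6 * k) *_) (fill N) ⟨
      3 ^ k * 15 ^ (6 * k) * (N ^ D * N ^ r)
        ≡⟨ shuffle₃ (3 ^ k) (15 ^ (6 * k)) (N ^ D) (N ^ r) ⟩
      15 ^ (6 * k) * N ^ r * (3 ^ k * N ^ D) ∎)
    where
    w = suc w′
    N = 16 + 16 * w′
    Y = 17 + 16 * w′
    K = 2 ^ k * 2 ^ h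
    r = j * w ∸ D
    e = 6 * k ∸ j
    split : ∀ a → a ^ (6 * k) ≡ a ^ j * a ^ e
    split a = trans (cong (a ^_) (sym (m+[n∸m]≡n j≤6k))) (^-distribˡ-+-* a j e)
    fill : ∀ a → a ^ D * a ^ r ≡ (a ^ w) ^ j
    fill a = begin-equality
      a ^ D * a ^ r   ≡⟨ ^-distribˡ-+-* a D r ⟨
      a ^ (D + r)     ≡⟨ cong (a ^_) (trans (m+[n∸m]≡n D≤jw) (*-comm j w)) ⟩
      a ^ (w * j)     ≡⟨ ^-*-assoc a w j ⟨
      (a ^ w) ^ j     ∎
    blocks : 15 ^ j * (Y ^ w) ^ j ≤ 16 ^ j * (N ^ w) ^ j
    blocks = begin
      15 ^ j * (Y ^ w) ^ j   ≡⟨ ^-distrib-* 15 (Y ^ w) j ⟨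
      (15 * Y ^ w) ^ j       ≤⟨ ^-monoˡ-≤ j (15*[16w+1]^w≤16*[16w]^w w′) ⟩
      (16 * N ^ w) ^ j       ≡⟨ ^-distrib-* 16 (N ^ w) j ⟩
      16 ^ j * (N ^ w) ^ j   ∎
    constants : 2 ^ h * (2 ^ k * 16 ^ (6 * k)) ≤ 3 ^ k * 15 ^ (6 * k)
    constants = begin
      2 ^ h * (2 ^ k * 16 ^ (6 * k))   ≡⟨ cong (λ x → 2 ^ h * (2 ^ k * x)) (^-*-assoc 16 6 k) ⟨
      2 ^ h * (2 ^ k * (16 ^ 6) ^ k)   ≡⟨ cong (2 ^ h *_) (^-distrib-* 2 (16 ^ 6) k) ⟨
      2 ^ h * (2 * 16 ^ 6) ^ k         ≤⟨ 2^h*[2*16^6]^k≤[3*15^6]^k k h 55h≤k ⟩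
      (3 * 15 ^ 6) ^ k                 ≡⟨ ^-distrib-* 3 (15 ^ 6) k ⟩
      3 ^ k * (15 ^ 6) ^ k             ≡⟨ cong (3 ^ k *_) (^-*-assoc 15 6 k) ⟩
      3 ^ k * 15 ^ (6 * k)             ∎
    shuffle₁ : ∀ a b c d f → a * b * c * (d * f) ≡ d * b * (a * (f * c))
    shuffle₁ = solve-∀
    shuffle₂ : ∀ a b c d f → a * b * c * (d * f) ≡ b * (a * (d * c)) * f
    shuffle₂ = solve-∀
    shuffle₃ : ∀ a b c d → a * b * (c * d) ≡ b * d * (a * c)
    shuffle₃ = solve-∀

module RandomLabellings where

  open import Data.Bool using (Bool; true; false; if_then_else_; _∧_)
  open import Data.Nat
  open import Data.Nat.Properties
  open import Data.Fin using (Fin; zero; suc)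
  open import Data.Fin.Subset using (Subset; _∩_; ∁; ∣_∣)
  open import Data.Vec using (Vec; []; _∷_; map)
  open import Data.Product using (∃; _,_)
  open import Function using (_∘_)
  open import Relation.Binary.PropositionalEquality
  open import Data.Nat.Tactic.RingSolver
  open Counting
  open PowerEstimates using (^-distrib-*)
  open import Algebra.Properties.CommutativeSemigroup *-commutativeSemigroup
    using (interchange; x∙yz≈y∙xz)
  open ≤-Reasoning

  isZero : ∀ {t} → Fin t → Bool
  isZero zero    = true
  isZero (suc _) = false

  module Labellings (t′ : ℕ) where

    t : ℕ
    t = suc t′

    chosen : ∀ {n} → Vec (Fin t) n → Subset n
    chosen = map isZero

    ∑ᴸ : (n : ℕ) → (Vec (Fin t) n → ℕ) → ℕ
    ∑ᴸ zero    g = g []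
    ∑ᴸ (suc n) g = ∑[ j < t ] ∑ᴸ n (λ z → g (j ∷ z))

    ∑ᴸ-mono : ∀ n {f g : Vec (Fin t) n → ℕ} → (∀ z → f z ≤ g z) → ∑ᴸ n f ≤ ∑ᴸ n g
    ∑ᴸ-mono zero    f≤g = f≤g []
    ∑ᴸ-mono (suc n) f≤g = ∑-mono (λ j → ∑ᴸ-mono n (λ z → f≤g (j ∷ z)))

    ∑ᴸ-distribˡ-* : ∀ n c (f : Vec (Fin t) n → ℕ) → ∑ᴸ n (λ z → c * f z) ≡ c * ∑ᴸ n f
    ∑ᴸ-distribˡ-* zero    c f = refl
    ∑ᴸ-distribˡ-* (suc n) c f = trans (sum-cong-≗ λ j → ∑ᴸ-distribˡ-* n c (f ∘ (j ∷_)))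
                                      (∑-distribˡ-* c λ j → ∑ᴸ n (f ∘ (j ∷_)))

    ∑ᴸ-distribʳ-* : ∀ n c (f : Vec (Fin t) n → ℕ) → ∑ᴸ n (λ z → f z * c) ≡ ∑ᴸ n f * c
    ∑ᴸ-distribʳ-* zero    c f = refl
    ∑ᴸ-distribʳ-* (suc n) c f = trans (sum-cong-≗ λ j → ∑ᴸ-distribʳ-* n c (f ∘ (j ∷_)))
                                      (∑-distribʳ-* c λ j → ∑ᴸ n (f ∘ (j ∷_)))

    ∑ᴸ-distrib-+ : ∀ n (f g : Vec (Fin t) n → ℕ) → ∑ᴸ n (λ z → f z + g z) ≡ ∑ᴸ n f + ∑ᴸ n g
    ∑ᴸ-distrib-+ zero    f g = refl
    ∑ᴸ-distrib-+ (suc n) f g = trans (sum-cong-≗ λ j → ∑ᴸ-distrib-+ n (f ∘ (j ∷_)) (g ∘ (j ∷_)))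
                                     (∑-distrib-+ (λ j → ∑ᴸ n (f ∘ (j ∷_))) (λ j → ∑ᴸ n (g ∘ (j ∷_))))

    ∑ᴸ-comm : ∀ n {k} (g : Fin k → Vec (Fin t) n → ℕ) →
              ∑ᴸ n (λ z → ∑[ e < k ] g e z) ≡ ∑[ e < k ] ∑ᴸ n (g e)
    ∑ᴸ-comm zero    g = refl
    ∑ᴸ-comm (suc n) g = trans (sum-cong-≗ λ j → ∑ᴸ-comm n (λ e → g e ∘ (j ∷_)))
                              (∑-comm (λ j e → ∑ᴸ n (g e ∘ (j ∷_))))

    ∑ᴸ-zero : ∀ n → ∑ᴸ n (λ _ → 0) ≡ 0
    ∑ᴸ-zero zero    = refl
    ∑ᴸ-zero (suc n) = trans (sum-cong-≗ {t} (λ _ → ∑ᴸ-zero n)) (trans (∑-const t 0) (*-zeroʳ t))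

    ∑ᴸ<t^n⇒∃≡0 : ∀ n (g : Vec (Fin t) n → ℕ) → ∑ᴸ n g < t ^ n → ∃ λ z → g z ≡ 0
    ∑ᴸ<t^n⇒∃≡0 zero    g ∑<1 = [] , n<1⇒n≡0 ∑<1
    ∑ᴸ<t^n⇒∃≡0 (suc n) g ∑<t^1+n with ∑<*⇒∃< (t ^ n) (λ j → ∑ᴸ n (λ z → g (j ∷ z))) ∑<t^1+n
    ... | j , ∑ⱼ<t^n with ∑ᴸ<t^n⇒∃≡0 n (λ z → g (j ∷ z)) ∑ⱼ<t^n
    ...   | z , gz≡0 = j ∷ z , gz≡0

    labelWeight : ℕ → ℕ → Bool → Fin t → ℕ
    labelWeight α β false j = 1
    labelWeight α β true  j = if isZero j then α else β

    weight : ∀ {n} → ℕ → ℕ → Subset n → Vec (Fin t) n → ℕ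
    weight α β []      []      = 1
    weight α β (x ∷ S) (j ∷ z) = labelWeight α β x j * weight α β S z

    weight≡ : ∀ {n} α β (S : Subset n) z →
              weight α β S z ≡ α ^ ∣ S ∩ chosen z ∣ * β ^ ∣ S ∩ ∁ (chosen z) ∣
    weight≡ α β []          []          = refl
    weight≡ α β (false ∷ S) (j ∷ z)     = trans (*-identityˡ _) (weight≡ α β S z)
    weight≡ α β (true ∷ S)  (zero ∷ z)  =
      trans (cong (α *_) (weight≡ α β S z)) (sym (*-assoc α (α ^ ∣ S ∩ chosen z ∣) _))
    weight≡ α β (true ∷ S)  (suc j ∷ z) =
      trans (cong (β *_) (weight≡ α β S z)) (x∙yz≈y∙xz β (α ^ ∣ S ∩ chosen z ∣) _)

    ∑-labelWeight : ∀ α β x → ∑[ j < t ] labelWeight α β x j ≡ (if x then α + t′ * β else t)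
    ∑-labelWeight α β true  = cong (α +_) (∑-const t′ β)
    ∑-labelWeight α β false = cong suc (trans (∑-const t′ 1) (*-identityʳ t′))

    ∑ᴸ-weight : ∀ n α β (S : Subset n) →
                ∑ᴸ n (weight α β S) * t ^ ∣ S ∣ ≡ (α + t′ * β) ^ ∣ S ∣ * t ^ n
    ∑ᴸ-weight zero    α β []      = refl
    ∑ᴸ-weight (suc n) α β (x ∷ S) = begin-equality
      ∑[ j < t ] ∑ᴸ n (λ z → labelWeight α β x j * weight α β S z) * t ^ ∣ x ∷ S ∣
        ≡⟨ cong (_* t ^ ∣ x ∷ S ∣) (trans (sum-cong-≗ (λ j → ∑ᴸ-distribˡ-* n (labelWeight α β x j) (weight α β S)))
                                        (∑-distribʳ-* W (labelWeight α β x))) ⟩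
      ∑[ j < t ] labelWeight α β x j * W * t ^ ∣ x ∷ S ∣
        ≡⟨ cong (λ s → s * W * t ^ ∣ x ∷ S ∣) (∑-labelWeight α β x) ⟩
      (if x then a else t) * W * t ^ ∣ x ∷ S ∣
        ≡⟨ step x ⟩
      a ^ ∣ x ∷ S ∣ * (t * t ^ n) ∎
      where
      a = α + t′ * β
      W = ∑ᴸ n (weight α β S)
      IH = ∑ᴸ-weight n α β S
      step : ∀ x → (if x then a else t) * W * t ^ ∣ x ∷ S ∣ ≡ a ^ ∣ x ∷ S ∣ * (t * t ^ n)
      step true = begin-equality
        a * W * (t * t ^ ∣ S ∣)          ≡⟨ interchange a W t (t ^ ∣ S ∣) ⟩
        a * t * (W * t ^ ∣ S ∣)          ≡⟨ cong (a * t *_) IH ⟩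
        a * t * (a ^ ∣ S ∣ * t ^ n)      ≡⟨ interchange a t (a ^ ∣ S ∣) (t ^ n) ⟩
        a * a ^ ∣ S ∣ * (t * t ^ n)      ∎
      step false = begin-equality
        t * W * t ^ ∣ S ∣                ≡⟨ *-assoc t W (t ^ ∣ S ∣) ⟩
        t * (W * t ^ ∣ S ∣)              ≡⟨ cong (t *_) IH ⟩
        t * (a ^ ∣ S ∣ * t ^ n)          ≡⟨ x∙yz≈y∙xz t (a ^ ∣ S ∣) (t ^ n) ⟩
        a ^ ∣ S ∣ * (t * t ^ n)          ∎

    module _ (h : ℕ) where

      -- Rare c f: the expectation of f over a uniform labelling is at most c / 2^h.
      record Rare {n} (c : ℕ) (f : Vec (Fin t) n → ℕ) : Set where
        constructor rare
        field
          bound : ∑ᴸ n f * 2 ^ h ≤ c * t ^ n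

      rare-never : ∀ {n} c → Rare c (λ (_ : Vec (Fin t) n) → 0)
      rare-never {n} c = rare (≤-trans (≤-reflexive (cong (_* 2 ^ h) (∑ᴸ-zero n))) z≤n)

      rare-guarded : ∀ {n} (a : Bool) (f : Vec (Fin t) n → Bool) →
                     (a ≡ true → Rare 1 (λ z → 𝟙 (f z))) → Rare 1 (λ z → 𝟙 (a ∧ f z))
      rare-guarded {n} false f _      = rare-never {n} 1
      rare-guarded {n} true  f rare-f = rare-f refl

      rare-+ : ∀ {n a b} {f g : Vec (Fin t) n → ℕ} → Rare a f → Rare b g →
               Rare (a + b) (λ z → f z + g z)
      rare-+ {n} {a} {b} {f} {g} (rare rf) (rare rg) = rare (begin
        ∑ᴸ n (λ z → f z + g z) * 2 ^ h        ≡⟨ cong (_* 2 ^ h) (∑ᴸ-distrib-+ n f g) ⟩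
        (∑ᴸ n f + ∑ᴸ n g) * 2 ^ h             ≡⟨ *-distribʳ-+ (2 ^ h) (∑ᴸ n f) _ ⟩
        ∑ᴸ n f * 2 ^ h + ∑ᴸ n g * 2 ^ h       ≤⟨ +-mono-≤ rf rg ⟩
        a * t ^ n + b * t ^ n                 ≡⟨ *-distribʳ-+ (t ^ n) a b ⟨
        (a + b) * t ^ n                       ∎)

      rare-∑ : ∀ {n k c} (f : Fin k → Vec (Fin t) n → ℕ) → (∀ e → Rare c (f e)) →
               Rare (k * c) (λ z → ∑[ e < k ] f e z)
      rare-∑ {n} {k} {c} f rf = rare (begin
        ∑ᴸ n (λ z → ∑[ e < k ] f e z) * 2 ^ h   ≡⟨ cong (_* 2 ^ h) (∑ᴸ-comm n f) ⟩
        (∑[ e < k ] ∑ᴸ n (f e)) * 2 ^ h         ≡⟨ ∑-distribʳ-* (2 ^ h) (λ e → ∑ᴸ n (f e)) ⟨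
        ∑[ e < k ] (∑ᴸ n (f e) * 2 ^ h)         ≤⟨ ∑-≤-const (λ e → Rare.bound (rf e)) ⟩
        k * (c * t ^ n)                         ≡⟨ *-assoc k c (t ^ n) ⟨
        k * c * t ^ n                           ∎)

      rare⇒∃≡0 : ∀ {n c} (f : Vec (Fin t) n → ℕ) → Rare c f → c < 2 ^ h → ∃ λ z → f z ≡ 0
      rare⇒∃≡0 {n} {c} f (rare rf) c<2^h = ∑ᴸ<t^n⇒∃≡0 n f (*-cancelʳ-< (2 ^ h) _ _ (begin-strict
        ∑ᴸ n f * 2 ^ h   ≤⟨ rf ⟩
        c * t ^ n        <⟨ *-monoˡ-< (t ^ n) {{m^n≢0 t n}} c<2^h ⟩
        2 ^ h * t ^ n    ≡⟨ *-comm (2 ^ h) (t ^ n) ⟩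
        t ^ n * 2 ^ h    ∎))

      -- Markov's inequality applied to the weight α^X 2^(|S|−X) of X = |S ∩ chosen z|.
      tail : ∀ {n} (S : Subset n) (bad : ℕ → Bool) α c d .{{_ : NonZero c}} →
        (∀ X Y → bad X ≡ true → c * 2 ^ (X + Y) ≤ α ^ X * 2 ^ Y * d) →
        d * 2 ^ h * (α + t′ * 2) ^ ∣ S ∣ ≤ c * (2 * t) ^ ∣ S ∣ →
        Rare 1 (λ z → 𝟙 (bad ∣ S ∩ chosen z ∣))
      tail {n} S bad α c d {{c≢0}} pointwise moment = rare (
        *-cancelˡ-≤ (c * (2 * t) ^ D) {{m*n≢0 c _ {{c≢0}} {{m^n≢0 (2 * t) D}}}} (begin
          c * (2 * t) ^ D * (I * 2 ^ h)      ≡⟨ cong (λ x → c * x * (I * 2 ^ h)) (^-distrib-* 2 t D) ⟩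
          c * (2 ^ D * t ^ D) * (I * 2 ^ h)  ≡⟨ regroup₁ c (2 ^ D) (t ^ D) I (2 ^ h) ⟩
          I * (c * 2 ^ D) * t ^ D * 2 ^ h    ≤⟨ *-monoˡ-≤ (2 ^ h) (*-monoˡ-≤ (t ^ D) markov) ⟩
          W * d * t ^ D * 2 ^ h              ≡⟨ regroup₂ W d (t ^ D) (2 ^ h) ⟩
          W * t ^ D * (d * 2 ^ h)            ≡⟨ cong (_* (d * 2 ^ h)) (∑ᴸ-weight n α 2 S) ⟩
          (α + t′ * 2) ^ D * t ^ n * (d * 2 ^ h) ≡⟨ regroup₃ ((α + t′ * 2) ^ D) (t ^ n) d (2 ^ h) ⟩
          d * 2 ^ h * (α + t′ * 2) ^ D * t ^ n   ≤⟨ *-monoˡ-≤ (t ^ n) moment ⟩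
          c * (2 * t) ^ D * t ^ n                ≡⟨ cong (c * (2 * t) ^ D *_) (+-identityʳ (t ^ n)) ⟨
          c * (2 * t) ^ D * (1 * t ^ n)          ∎))
        where
        D = ∣ S ∣
        I = ∑ᴸ n (λ z → 𝟙 (bad ∣ S ∩ chosen z ∣))
        W = ∑ᴸ n (weight α 2 S)
        atBad : ∀ z → 𝟙 (bad ∣ S ∩ chosen z ∣) * (c * 2 ^ D) ≤ weight α 2 S z * d
        atBad z with bad ∣ S ∩ chosen z ∣ in bad≡
        ... | false = z≤n
        ... | true  = begin
          1 * (c * 2 ^ D)                            ≡⟨ *-identityˡ _ ⟩
          c * 2 ^ D                                  ≡⟨ cong (λ x → c * 2 ^ x) (∣p∩q∣+∣p∩∁q∣≡∣p∣ S (chosen z)) ⟨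
          c * 2 ^ (∣ S ∩ chosen z ∣ + ∣ S ∩ ∁ (chosen z) ∣) ≤⟨ pointwise _ _ bad≡ ⟩
          α ^ ∣ S ∩ chosen z ∣ * 2 ^ ∣ S ∩ ∁ (chosen z) ∣ * d ≡⟨ cong (_* d) (weight≡ α 2 S z) ⟨
          weight α 2 S z * d                         ∎
        markov : I * (c * 2 ^ D) ≤ W * d
        markov = begin
          I * (c * 2 ^ D)                                      ≡⟨ ∑ᴸ-distribʳ-* n _ _ ⟨
          ∑ᴸ n (λ z → 𝟙 (bad ∣ S ∩ chosen z ∣) * (c * 2 ^ D)) ≤⟨ ∑ᴸ-mono n atBad ⟩
          ∑ᴸ n (λ z → weight α 2 S z * d)                      ≡⟨ ∑ᴸ-distribʳ-* n d (weight α 2 S) ⟩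
          W * d                                                ∎
        regroup₁ : ∀ c a b i f → c * (a * b) * (i * f) ≡ i * (c * a) * b * f
        regroup₁ = solve-∀
        regroup₂ : ∀ w a b c → w * a * b * c ≡ w * b * (a * c)
        regroup₂ = solve-∀
        regroup₃ : ∀ a b c d → a * b * (c * d) ≡ c * d * a * b
        regroup₃ = solve-∀

      lowerTail : ∀ {n} (S : Subset n) (bad : ℕ → Bool) k → (∀ X → bad X ≡ true → X ≤ k) →
        2 ^ k * 2 ^ h * (1 + t′ * 2) ^ ∣ S ∣ ≤ (2 * t) ^ ∣ S ∣ →
        Rare 1 (λ z → 𝟙 (bad ∣ S ∩ chosen z ∣))
      lowerTail S bad k X≤k moment =
        tail S bad 1 1 (2 ^ k) pointwise (≤-trans moment (≤-reflexive (sym (*-identityˡ _))))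
        where
        pointwise : ∀ X Y → bad X ≡ true → 1 * 2 ^ (X + Y) ≤ 1 ^ X * 2 ^ Y * 2 ^ k
        pointwise X Y bad≡ = begin
          1 * 2 ^ (X + Y)          ≡⟨ *-identityˡ _ ⟩
          2 ^ (X + Y)              ≤⟨ ^-monoʳ-≤ 2 (+-monoˡ-≤ Y (X≤k X bad≡)) ⟩
          2 ^ (k + Y)              ≡⟨ ^-distribˡ-+-* 2 k Y ⟩
          2 ^ k * 2 ^ Y            ≡⟨ *-comm (2 ^ k) (2 ^ Y) ⟩
          2 ^ Y * 2 ^ k            ≡⟨ cong (_* 2 ^ k) (*-identityˡ (2 ^ Y)) ⟨
          1 * 2 ^ Y * 2 ^ k        ≡⟨ cong (λ x → x * 2 ^ Y * 2 ^ k) (^-zeroˡ X) ⟨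
          1 ^ X * 2 ^ Y * 2 ^ k    ∎

      upperTail : ∀ {n} (S : Subset n) (bad : ℕ → Bool) k → (∀ X → bad X ≡ true → k ≤ X) →
        2 ^ k * 2 ^ h * (3 + t′ * 2) ^ ∣ S ∣ ≤ 3 ^ k * (2 * t) ^ ∣ S ∣ →
        Rare 1 (λ z → 𝟙 (bad ∣ S ∩ chosen z ∣))
      upperTail S bad k k≤X moment = tail S bad 3 (3 ^ k) (2 ^ k) {{m^n≢0 3 k}} pointwise moment
        where
        pointwise : ∀ X Y → bad X ≡ true → 3 ^ k * 2 ^ (X + Y) ≤ 3 ^ X * 2 ^ Y * 2 ^ k
        pointwise X Y bad≡ = begin
          3 ^ k * 2 ^ (X + Y)            ≡⟨ cong (λ x → 3 ^ k * 2 ^ (x + Y)) X≡ ⟨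
          3 ^ k * 2 ^ (k + e + Y)        ≡⟨ cong (3 ^ k *_) (trans (^-distribˡ-+-* 2 (k + e) Y)
                                                              (cong (_* 2 ^ Y) (^-distribˡ-+-* 2 k e))) ⟩
          3 ^ k * (2 ^ k * 2 ^ e * 2 ^ Y) ≤⟨ *-monoʳ-≤ (3 ^ k) (*-monoˡ-≤ (2 ^ Y)
                                               (*-monoʳ-≤ (2 ^ k) (^-monoˡ-≤ e (n≤1+n 2)))) ⟩
          3 ^ k * (2 ^ k * 3 ^ e * 2 ^ Y) ≡⟨ regroup (3 ^ k) (2 ^ k) (3 ^ e) (2 ^ Y) ⟩
          3 ^ k * 3 ^ e * 2 ^ Y * 2 ^ k  ≡⟨ cong (λ x → x * 2 ^ Y * 2 ^ k) (^-distribˡ-+-* 3 k e) ⟨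
          3 ^ (k + e) * 2 ^ Y * 2 ^ k    ≡⟨ cong (λ x → 3 ^ x * 2 ^ Y * 2 ^ k) X≡ ⟩
          3 ^ X * 2 ^ Y * 2 ^ k          ∎
          where
          e = X ∸ k
          X≡ : k + e ≡ X
          X≡ = m+[n∸m]≡n (k≤X X bad≡)
          regroup : ∀ a b c d → a * (b * c * d) ≡ a * c * d * b
          regroup = solve-∀

module Parameters where

  open import Data.Nat
  open import Data.Nat.Properties
  open import Data.Nat.DivMod using (_/_; _%_; m≡m%n+[m/n]*n; m%n<n)
  open import Data.List using ([]; _∷_)
  open import Data.Product using (_×_; _,_)
  open import Data.Unit using (tt)
  open import Relation.Binary.PropositionalEquality
  open import Data.Nat.Tactic.RingSolver
  open ≤-Reasoning

  m<[1+m/n]*n : ∀ m n .{{_ : NonZero n}} → m < suc (m / n) * n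
  m<[1+m/n]*n m n = begin-strict
    m                  ≡⟨ m≡m%n+[m/n]*n m n ⟩
    m % n + m / n * n  <⟨ +-monoˡ-< (m / n * n) (m%n<n m n) ⟩
    n + m / n * n      ∎

  9n≤10ms : ∀ {n b₀ m s} → 10 * b₀ ≤ n → n ≤ b₀ + m * s → 9 * n ≤ 10 * (m * s)
  9n≤10ms {n} {b₀} {m} {s} 10b₀≤n n≤b₀+ms = +-cancelʳ-≤ n _ _ (begin
    9 * n + n                ≡⟨ solve (n ∷ []) ⟩
    10 * n                   ≤⟨ *-monoʳ-≤ 10 n≤b₀+ms ⟩
    10 * (b₀ + m * s)        ≡⟨ *-distribˡ-+ 10 b₀ (m * s) ⟩
    10 * b₀ + 10 * (m * s)   ≤⟨ +-monoˡ-≤ _ 10b₀≤n ⟩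
    n + 10 * (m * s)         ≡⟨ +-comm n _ ⟩
    10 * (m * s) + n         ∎)

  a<b*n⇒1≤n : ∀ a b n → a < b * n → 1 ≤ n
  a<b*n⇒1≤n a b n a<bn = *-cancelˡ-< b 0 n (subst (_< b * n) (sym (*-zeroʳ b)) (≤-<-trans z≤n a<bn))

  -- p = P/Q, w ≈ 1/(10p), L ≈ (log n)² and 2^h exceeds the number of events.
  record Constraints (n m s b₀ P Q w L h : ℕ) : Set where
    field
      1≤P        : 1 ≤ P
      100P<Q     : 100 * P < Q
      10Pw≤Q     : 10 * P * w ≤ Q
      Q<10P[1+w] : Q < 10 * P * suc w
      11≤m       : 11 ≤ m
      1≤L        : 1 ≤ L
      Lm²Q²<P²n  : L * (m * m) * (Q * Q) < P * P * n
      h≤8L       : h ≤ 8 * L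
      5nm<2^h    : 5 * (n * m) < 2 ^ h
      10b₀≤n     : 10 * b₀ ≤ n
      n≤b₀+ms    : n ≤ b₀ + m * s
      ms≤n       : m * s ≤ n

  module ParameterArithmetic {n m s b₀ P Q w L h : ℕ} (constraints : Constraints n m s b₀ P Q w L h) where

    open Constraints constraints

    instance
      P≢0 : NonZero P
      P≢0 = >-nonZero 1≤P
      Q≢0 : NonZero Q
      Q≢0 = >-nonZero (≤-<-trans z≤n 100P<Q)
      10P≢0 : NonZero (10 * P)
      10P≢0 = m*n≢0 10 P

    1≤n : 1 ≤ n
    1≤n = a<b*n⇒1≤n _ (P * P) n Lm²Q²<P²n

    #events<2^h : 1 + 1 + m * 1 + n * (m * 1) + n * 1 < 2 ^ h
    #events<2^h = ≤-<-trans (begin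
      1 + 1 + m * 1 + n * (m * 1) + n * 1    ≡⟨ solve (m ∷ n ∷ []) ⟩
      2 * 1 + m + n * m + n                  ≤⟨ +-mono-≤ (+-mono-≤ (+-mono-≤ (*-monoʳ-≤ 2 1≤nm) m≤nm) ≤-refl) n≤nm ⟩
      2 * (n * m) + n * m + n * m + n * m    ≡⟨ solve (m ∷ n ∷ []) ⟩
      5 * (n * m)                            ∎) 5nm<2^h
      where
      1≤m : 1 ≤ m
      1≤m = ≤-trans (s≤s z≤n) 11≤m
      1≤nm : 1 ≤ n * m
      1≤nm = *-mono-≤ 1≤n 1≤m
      m≤nm : m ≤ n * m
      m≤nm = ≤-trans (≤-reflexive (sym (*-identityˡ m))) (*-monoˡ-≤ m 1≤n)
      n≤nm : n ≤ n * m
      n≤nm = ≤-trans (≤-reflexive (sym (*-identityʳ n))) (*-monoʳ-≤ n 1≤m)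

    10≤w : 10 ≤ w
    10≤w = s≤s⁻¹ (*-cancelˡ-< (10 * P) 10 (suc w) (begin-strict
      10 * P * 10     ≡⟨ solve (P ∷ []) ⟩
      100 * P         <⟨ 100P<Q ⟩
      Q               <⟨ Q<10P[1+w] ⟩
      10 * P * suc w  ∎))

    Q≤11Pw : Q ≤ 11 * P * w
    Q≤11Pw = begin
      Q                    ≤⟨ <⇒≤ Q<10P[1+w] ⟩
      10 * P * suc w       ≡⟨ solve (P ∷ w ∷ []) ⟩
      10 * P * w + P * 10  ≤⟨ +-monoʳ-≤ (10 * P * w) (*-monoʳ-≤ P 10≤w) ⟩
      10 * P * w + P * w   ≡⟨ solve (P ∷ w ∷ []) ⟩
      11 * P * w           ∎

    100Lm²Q<Pn : 100 * L * (m * m) * Q < P * n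
    100Lm²Q<Pn = *-cancelˡ-< P _ _ (begin-strict
      P * (100 * L * (m * m) * Q)  ≡⟨ solve (P ∷ L ∷ m ∷ Q ∷ []) ⟩
      L * (m * m) * Q * (100 * P)  ≤⟨ *-monoʳ-≤ (L * (m * m) * Q) (<⇒≤ 100P<Q) ⟩
      L * (m * m) * Q * Q          ≡⟨ *-assoc (L * (m * m)) Q Q ⟩
      L * (m * m) * (Q * Q)        <⟨ Lm²Q²<P²n ⟩
      P * P * n                    ≡⟨ *-assoc P P n ⟩
      P * (P * n)                  ∎)

    9LmQ²<10P²s : 9 * L * m * (Q * Q) < 10 * (P * P) * s
    9LmQ²<10P²s = *-cancelˡ-< m _ _ (begin-strict
      m * (9 * L * m * (Q * Q))  ≡⟨ solve (m ∷ L ∷ Q ∷ []) ⟩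
      9 * (L * (m * m) * (Q * Q)) <⟨ *-monoʳ-< 9 Lm²Q²<P²n ⟩
      9 * (P * P * n)            ≡⟨ solve (P ∷ n ∷ []) ⟩
      P * P * (9 * n)            ≤⟨ *-monoʳ-≤ (P * P) (9n≤10ms {m = m} {s} 10b₀≤n n≤b₀+ms) ⟩
      P * P * (10 * (m * s))     ≡⟨ solve (P ∷ m ∷ s ∷ []) ⟩
      m * (10 * (P * P) * s)     ∎)

    90LmQ<Ps : 90 * L * m * Q < P * s
    90LmQ<Ps = *-cancelˡ-< (10 * P) _ _ (begin-strict
      10 * P * (90 * L * m * Q)  ≡⟨ solve (P ∷ L ∷ m ∷ Q ∷ []) ⟩
      9 * L * m * Q * (100 * P)  ≤⟨ *-monoʳ-≤ (9 * L * m * Q) (<⇒≤ 100P<Q) ⟩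
      9 * L * m * Q * Q          ≡⟨ *-assoc (9 * L * m) Q Q ⟩
      9 * L * m * (Q * Q)        <⟨ 9LmQ²<10P²s ⟩
      10 * (P * P) * s           ≡⟨ solve (P ∷ s ∷ []) ⟩
      10 * P * (P * s)           ∎)

    990LQ<Pn : 990 * L * Q < P * n
    990LQ<Pn = ≤-<-trans (*-monoˡ-≤ Q (begin
      990 * L              ≤⟨ *-monoˡ-≤ L (≤ᵇ⇒≤ 990 12100 tt) ⟩
      12100 * L            ≡⟨ solve (L ∷ []) ⟩
      100 * L * 121        ≤⟨ *-monoʳ-≤ (100 * L) (*-mono-≤ 11≤m 11≤m) ⟩
      100 * L * (m * m)    ∎)) 100Lm²Q<Pn

    990LQ<Ps : 990 * L * Q < P * s
    990LQ<Ps = ≤-<-trans (begin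
      990 * L * Q          ≡⟨ solve (L ∷ Q ∷ []) ⟩
      90 * L * 11 * Q      ≤⟨ *-monoˡ-≤ Q (*-monoʳ-≤ (90 * L) 11≤m) ⟩
      90 * L * m * Q       ∎) 90LmQ<Ps

    60hw≤n : 60 * h * w ≤ n
    60hw≤n = *-cancelˡ-≤ (10 * P) (begin
      10 * P * (60 * h * w)   ≡⟨ solve (P ∷ h ∷ w ∷ []) ⟩
      60 * h * (10 * P * w)   ≤⟨ *-monoʳ-≤ (60 * h) 10Pw≤Q ⟩
      60 * h * Q              ≤⟨ *-monoˡ-≤ Q (*-monoʳ-≤ 60 h≤8L) ⟩
      60 * (8 * L) * Q        ≡⟨ solve (L ∷ Q ∷ []) ⟩
      480 * L * Q             ≤⟨ *-monoˡ-≤ Q (*-monoˡ-≤ L (≤ᵇ⇒≤ 480 1000 tt)) ⟩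
      1000 * L * Q            ≡⟨ solve (L ∷ Q ∷ []) ⟩
      100 * L * 10 * Q        ≤⟨ *-monoˡ-≤ Q (*-monoʳ-≤ (100 * L) (≤-trans (≤ᵇ⇒≤ 10 121 tt) (*-mono-≤ 11≤m 11≤m))) ⟩
      100 * L * (m * m) * Q   ≤⟨ <⇒≤ 100Lm²Q<Pn ⟩
      P * n                   ≤⟨ *-monoˡ-≤ n (m≤n*m P 10) ⟩
      10 * P * n              ∎)

    180hw<deg : ∀ deg → 30 * P * s < deg * Q → 180 * h * w < deg
    180hw<deg deg 30Ps<degQ = *-cancelˡ-< (10 * P) _ _ (begin-strict
      10 * P * (180 * h * w)  ≡⟨ solve (P ∷ h ∷ w ∷ []) ⟩
      180 * h * (10 * P * w)  ≤⟨ *-monoʳ-≤ (180 * h) 10Pw≤Q ⟩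
      180 * h * Q             ≡⟨ solve (h ∷ Q ∷ []) ⟩
      10 * (18 * h * Q)       <⟨ *-monoʳ-< 10 18hQ<Pdeg ⟩
      10 * (P * deg)          ≡⟨ *-assoc 10 P deg ⟨
      10 * P * deg            ∎)
      where
      18hQ<Pdeg : 18 * h * Q < P * deg
      18hQ<Pdeg = *-cancelˡ-< Q _ _ (begin-strict
        Q * (18 * h * Q)        ≡⟨ solve (Q ∷ h ∷ []) ⟩
        18 * h * (Q * Q)        ≤⟨ *-monoˡ-≤ (Q * Q) (*-monoʳ-≤ 18 h≤8L) ⟩
        18 * (8 * L) * (Q * Q)  ≡⟨ solve (L ∷ Q ∷ []) ⟩
        L * 144 * (Q * Q)       ≤⟨ *-monoˡ-≤ (Q * Q) (*-monoʳ-≤ L (≤-trans (≤ᵇ⇒≤ 144 297 tt) (*-monoʳ-≤ 27 11≤m))) ⟩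
        L * (27 * m) * (Q * Q)  ≡⟨ solve (L ∷ m ∷ Q ∷ []) ⟩
        3 * (9 * L * m * (Q * Q)) <⟨ *-monoʳ-< 3 9LmQ²<10P²s ⟩
        3 * (10 * (P * P) * s)  ≡⟨ solve (P ∷ s ∷ []) ⟩
        P * (30 * P * s)        <⟨ *-monoʳ-< P 30Ps<degQ ⟩
        P * (deg * Q)           ≡⟨ solve (P ∷ deg ∷ Q ∷ []) ⟩
        Q * (P * deg)           ∎)

    12000hw<n : 12000 * h * w < n
    12000hw<n = *-cancelˡ-< (10 * P) _ _ (begin-strict
      10 * P * (12000 * h * w)  ≡⟨ solve (P ∷ h ∷ w ∷ []) ⟩
      12000 * h * (10 * P * w)  ≤⟨ *-monoʳ-≤ (12000 * h) 10Pw≤Q ⟩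
      12000 * h * Q             ≤⟨ *-monoˡ-≤ Q (*-monoʳ-≤ 12000 h≤8L) ⟩
      12000 * (8 * L) * Q       ≡⟨ solve (L ∷ Q ∷ []) ⟩
      L * 96000 * Q             ≤⟨ *-monoˡ-≤ Q (*-monoʳ-≤ L (≤-trans (≤ᵇ⇒≤ 96000 121000 tt)
                                                                (*-monoʳ-≤ 1000 (*-mono-≤ 11≤m 11≤m)))) ⟩
      L * (1000 * (m * m)) * Q  ≡⟨ solve (L ∷ m ∷ Q ∷ []) ⟩
      10 * (100 * L * (m * m) * Q) <⟨ *-monoʳ-< 10 100Lm²Q<Pn ⟩
      10 * (P * n)              ≡⟨ *-assoc 10 P n ⟨
      10 * P * n                ∎)

    ckw≤R : ∀ c k R → c * Q * k ≤ P * R → 10 * c * k * w ≤ R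
    ckw≤R c k R cQk≤PR = *-cancelˡ-≤ Q (begin
      Q * (10 * c * k * w)   ≡⟨ solve (Q ∷ c ∷ k ∷ w ∷ []) ⟩
      10 * w * (c * Q * k)   ≤⟨ *-monoʳ-≤ (10 * w) cQk≤PR ⟩
      10 * w * (P * R)       ≡⟨ solve (w ∷ P ∷ R ∷ []) ⟩
      10 * P * w * R         ≤⟨ *-monoˡ-≤ R 10Pw≤Q ⟩
      Q * R                  ∎)

    5B≤n : ∀ B → B * Q ≤ b₀ * Q + 10 * P * (m * s) → 5 * B ≤ n
    5B≤n B BQ≤ = *-cancelˡ-≤ 2 (*-cancelˡ-≤ Q (begin
      Q * (2 * (5 * B))                   ≡⟨ solve (Q ∷ B ∷ []) ⟩
      10 * (B * Q)                        ≤⟨ *-monoʳ-≤ 10 BQ≤ ⟩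
      10 * (b₀ * Q + 10 * P * (m * s))    ≡⟨ solve (b₀ ∷ Q ∷ P ∷ m ∷ s ∷ []) ⟩
      10 * b₀ * Q + 100 * P * (m * s)     ≤⟨ +-mono-≤ (*-monoˡ-≤ Q 10b₀≤n) (*-mono-≤ (<⇒≤ 100P<Q) ms≤n) ⟩
      n * Q + Q * n                       ≡⟨ solve (n ∷ Q ∷ []) ⟩
      Q * (2 * n)                         ∎))

    lowerTail-large : ∀ k D B → D + B ≡ n → 5 * B ≤ n → 2 * Q * k ≤ P * n → 12 * (k + h) * w ≤ D
    lowerTail-large k D B D+B≡n 5B≤n 2Qk≤Pn = *-cancelˡ-≤ 5 (+-cancelʳ-≤ (5 * B) _ _ (begin
      5 * (12 * (k + h) * w) + 5 * B  ≡⟨ solve (k ∷ h ∷ w ∷ B ∷ []) ⟩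
      3 * (20 * k * w) + 60 * h * w + 5 * B
        ≤⟨ +-mono-≤ (+-mono-≤ (*-monoʳ-≤ 3 (ckw≤R 2 k n 2Qk≤Pn)) 60hw≤n) 5B≤n ⟩
      3 * n + n + n                   ≡⟨ solve (n ∷ []) ⟩
      5 * n                           ≡⟨ cong (5 *_) D+B≡n ⟨
      5 * (D + B)                     ≡⟨ *-distribˡ-+ 5 D B ⟩
      5 * D + 5 * B                   ∎))

    lowerTail-inPart : ∀ k D deg b → deg ≤ D + b → b * Q ≤ 10 * P * s → 30 * P * s < deg * Q →
                       2 * Q * k ≤ P * deg → 12 * (k + h) * w ≤ D
    lowerTail-inPart k D deg b deg≤D+b bQ≤10Ps 30Ps<degQ 2Qk≤Pdeg =
      <⇒≤ (*-cancelˡ-< 15 _ _ (+-cancelʳ-< (5 * deg) _ _ (begin-strict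
        15 * (12 * (k + h) * w) + 5 * deg  ≡⟨ solve (k ∷ h ∷ w ∷ deg ∷ []) ⟩
        9 * (20 * k * w) + 180 * h * w + 5 * deg
          ≤⟨ +-monoˡ-≤ (5 * deg) (+-mono-≤ (*-monoʳ-≤ 9 (ckw≤R 2 k deg 2Qk≤Pdeg)) (<⇒≤ (180hw<deg deg 30Ps<degQ))) ⟩
        9 * deg + deg + 5 * deg            ≡⟨ solve (deg ∷ []) ⟩
        15 * deg                           ≤⟨ *-monoʳ-≤ 15 deg≤D+b ⟩
        15 * (D + b)                       ≡⟨ solve (D ∷ b ∷ []) ⟩
        15 * D + 5 * (3 * b)               <⟨ +-monoʳ-< (15 * D) (*-monoʳ-< 5 3b<deg) ⟩
        15 * D + 5 * deg                   ∎)))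
      where
      3b<deg : 3 * b < deg
      3b<deg = *-cancelʳ-< Q (3 * b) deg (begin-strict
        3 * b * Q         ≡⟨ *-assoc 3 b Q ⟩
        3 * (b * Q)       ≤⟨ *-monoʳ-≤ 3 bQ≤10Ps ⟩
        3 * (10 * P * s)  ≡⟨ solve (P ∷ s ∷ []) ⟩
        30 * P * s        <⟨ 30Ps<degQ ⟩
        deg * Q           ∎)

    lowerTail-dense : ∀ k D → n < 40 * D → 50 * Q * k ≤ P * n → 12 * (k + h) * w ≤ D
    lowerTail-dense k D n<40D 50Qk≤Pn = <⇒≤ (*-cancelˡ-< 40 _ _ (≤-<-trans (*-cancelˡ-≤ 25 (begin
      25 * (40 * (12 * (k + h) * w))   ≡⟨ solve (k ∷ h ∷ w ∷ []) ⟩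
      24 * (10 * 50 * k * w) + 12000 * h * w
        ≤⟨ +-mono-≤ (*-monoʳ-≤ 24 (ckw≤R 50 k n 50Qk≤Pn)) (<⇒≤ 12000hw<n) ⟩
      24 * n + n                       ≡⟨ solve (n ∷ []) ⟩
      25 * n                           ∎)) n<40D))

    upperTail-condition : ∀ R k q → 990 * L * Q < P * R → 2 * P * R < Q * k → q * w ≤ R →
                          55 * h ≤ k × suc q ≤ 6 * k
    upperTail-condition R k q 990LQ<PR 2PR<Qk qw≤R = 55h≤k , 1+q≤6k
      where
      1980L<k : 1980 * L < k
      1980L<k = *-cancelˡ-< Q _ _ (begin-strict
        Q * (1980 * L)      ≡⟨ solve (Q ∷ L ∷ []) ⟩
        2 * (990 * L * Q)   <⟨ *-monoʳ-< 2 990LQ<PR ⟩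
        2 * (P * R)         ≡⟨ *-assoc 2 P R ⟨
        2 * P * R           <⟨ 2PR<Qk ⟩
        Q * k               ∎)
      55h≤k : 55 * h ≤ k
      55h≤k = begin
        55 * h         ≤⟨ *-monoʳ-≤ 55 h≤8L ⟩
        55 * (8 * L)   ≡⟨ solve (L ∷ []) ⟩
        440 * L        ≤⟨ *-monoˡ-≤ L (≤ᵇ⇒≤ 440 1980 tt) ⟩
        1980 * L       ≤⟨ <⇒≤ 1980L<k ⟩
        k              ∎
      Q≤PR : Q ≤ P * R
      Q≤PR = begin
        Q             ≡⟨ *-identityˡ Q ⟨
        1 * Q         ≤⟨ *-monoˡ-≤ Q (≤-trans 1≤L (m≤n*m L 990)) ⟩
        990 * L * Q   ≤⟨ <⇒≤ 990LQ<PR ⟩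
        P * R         ∎
      1+q≤6k : suc q ≤ 6 * k
      1+q≤6k = <⇒≤ (*-cancelˡ-< Q _ _ (begin-strict
        Q * suc q              ≡⟨ solve (Q ∷ q ∷ []) ⟩
        Q * q + Q              ≤⟨ +-monoˡ-≤ Q (*-monoˡ-≤ q Q≤11Pw) ⟩
        11 * P * w * q + Q     ≡⟨ cong (_+ Q) (solve (P ∷ w ∷ q ∷ [])) ⟩
        11 * P * (q * w) + Q   ≤⟨ +-mono-≤ (*-monoʳ-≤ (11 * P) qw≤R) Q≤PR ⟩
        11 * P * R + P * R     ≡⟨ solve (P ∷ R ∷ []) ⟩
        6 * (2 * P * R)        <⟨ *-monoʳ-< 6 2PR<Qk ⟩
        6 * (Q * k)            ≡⟨ solve (Q ∷ k ∷ []) ⟩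
        Q * (6 * k)            ∎))

module LogarithmicBounds where

  open import Data.Nat
  open import Data.Nat.Properties
  open import Data.List using ([]; _∷_)
  open import Data.Empty using (⊥-elim)
  open import Data.Unit using (tt)
  open import Relation.Binary.PropositionalEquality
  open import Data.Nat.Tactic.RingSolver
  open ExponentialSeries
  open ≤-Reasoning

  n<2^n : ∀ n → n < 2 ^ n
  n<2^n zero    = s≤s z≤n
  n<2^n (suc n) = begin-strict
    suc n        ≤⟨ n<2^n n ⟩
    2 ^ n        <⟨ m<m+n (2 ^ n) (m^n>0 2 n) ⟩
    2 ^ n + 2 ^ n ≡⟨ cong (2 ^ n +_) (+-identityʳ (2 ^ n)) ⟨
    2 * 2 ^ n    ∎

  expBound≤2^ : ∀ A → expBound A ≤ 2 ^ (suc A + A * (2 * A))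
  expBound≤2^ A = begin
    (2 + 2 * A) * A ^ (2 * A)          ≡⟨ cong (_* A ^ (2 * A)) 2+2A≡2[1+A] ⟩
    2 * suc A * A ^ (2 * A)            ≤⟨ *-mono-≤ (*-monoʳ-≤ 2 (n<2^n A)) (^-monoˡ-≤ (2 * A) (<⇒≤ (n<2^n A))) ⟩
    2 * 2 ^ A * (2 ^ A) ^ (2 * A)      ≡⟨ cong (2 * 2 ^ A *_) (^-*-assoc 2 A (2 * A)) ⟩
    2 ^ suc A * 2 ^ (A * (2 * A))      ≡⟨ ^-distribˡ-+-* 2 (suc A) (A * (2 * A)) ⟨
    2 ^ (suc A + A * (2 * A))          ∎
    where
    2+2A≡2[1+A] : 2 + 2 * A ≡ 2 * suc A
    2+2A≡2[1+A] = solve (A ∷ [])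

  5nm<2^[4A²+4A+3] : ∀ A n m → 1 ≤ A → n < expBound A → m ≤ n → 5 * (n * m) < 2 ^ (4 * A * A + 4 * A + 3)
  5nm<2^[4A²+4A+3] A n m 1≤A n<bound m≤n = begin-strict
    5 * (n * m)            ≤⟨ *-mono-≤ (≤ᵇ⇒≤ 5 8 tt) (*-monoʳ-≤ n m≤n) ⟩
    8 * (n * n)            <⟨ *-monoʳ-< 8 (*-mono-< n<2^e n<2^e) ⟩
    8 * (2 ^ e * 2 ^ e)    ≡⟨ cong (8 *_) (^-distribˡ-+-* 2 e e) ⟨
    2 ^ 3 * 2 ^ (e + e)    ≡⟨ ^-distribˡ-+-* 2 3 (e + e) ⟨
    2 ^ (3 + (e + e))      ≤⟨ ^-monoʳ-≤ 2 (begin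
      3 + (e + e)                  ≡⟨ expand A ⟩
      4 * A * A + (2 * A + 2) + 3  ≤⟨ +-monoˡ-≤ 3 (+-monoʳ-≤ (4 * A * A) (+-monoʳ-≤ (2 * A) (*-monoʳ-≤ 2 1≤A))) ⟩
      4 * A * A + (2 * A + 2 * A) + 3 ≡⟨ solve (A ∷ []) ⟩
      4 * A * A + 4 * A + 3        ∎) ⟩
    2 ^ (4 * A * A + 4 * A + 3) ∎
    where
    e = suc A + A * (2 * A)
    n<2^e : n < 2 ^ e
    n<2^e = <-≤-trans n<bound (expBound≤2^ A)
    expand : ∀ A → 3 + ((suc A + A * (2 * A)) + (suc A + A * (2 * A))) ≡ 4 * A * A + (2 * A + 2) + 3
    expand = solve-∀

  n<expBound[1+A]⇒4≤A : ∀ A n → n < expBound (suc A) → 1210000 * (A * A) < n → 10 ≤ n → 4 ≤ A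
  n<expBound[1+A]⇒4≤A 0 n n<bound _       10≤n = ⊥-elim (≤⇒≤ᵇ (≤-trans 10≤n (<⇒≤ n<bound)))
  n<expBound[1+A]⇒4≤A 1 n n<bound big<n _ = ⊥-elim (≤⇒≤ᵇ (<⇒≤ (<-trans big<n n<bound)))
  n<expBound[1+A]⇒4≤A 2 n n<bound big<n _ = ⊥-elim (≤⇒≤ᵇ (<⇒≤ (<-trans big<n n<bound)))
  n<expBound[1+A]⇒4≤A 3 n n<bound big<n _ = ⊥-elim (≤⇒≤ᵇ (<⇒≤ (<-trans big<n n<bound)))
  n<expBound[1+A]⇒4≤A (suc (suc (suc (suc A)))) _ _ _ _ = s≤s (s≤s (s≤s (s≤s z≤n)))

  4[1+A]²+4[1+A]+3≤8A² : ∀ A → 4 ≤ A → 4 * suc A * suc A + 4 * suc A + 3 ≤ 8 * (A * A)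
  4[1+A]²+4[1+A]+3≤8A² A 4≤A = begin
    4 * suc A * suc A + 4 * suc A + 3                ≡⟨ cong (λ x → 4 * suc x * suc x + 4 * suc x + 3) A≡ ⟨
    4 * suc (4 + x) * suc (4 + x) + 4 * suc (4 + x) + 3 ≤⟨ m≤m+n _ (5 + 20 * x + 4 * x * x) ⟩
    4 * suc (4 + x) * suc (4 + x) + 4 * suc (4 + x) + 3 + (5 + 20 * x + 4 * x * x) ≡⟨ expand x ⟩
    8 * ((4 + x) * (4 + x))                          ≡⟨ cong (λ y → 8 * (y * y)) A≡ ⟩
    8 * (A * A)                                      ∎
    where
    x = A ∸ 4
    A≡ : 4 + x ≡ A
    A≡ = m+[n∸m]≡n 4≤A
    expand : ∀ x → 4 * suc (4 + x) * suc (4 + x) + 4 * suc (4 + x) + 3 + (5 + 20 * x + 4 * x * x)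
                 ≡ 8 * ((4 + x) * (4 + x))
    expand = solve-∀

module RandomSelection where

  open import Data.Bool using (Bool; true; false; _∧_; T)
  open import Data.Nat
  open import Data.Nat.Properties
  open import Data.Nat.DivMod using (_/_; m/n*n≤m)
  open import Data.Fin using (Fin)
  open import Data.Fin.Subset using (Subset; _⊆_; _∩_; ∁; ∣_∣)
  open import Data.Fin.Subset.Properties using (p∩q⊆p; ∣p∣≤n; ∣p∩q∣≤∣q∣; ∣∁p∣≡n∸∣p∣; ∩-assoc; ∩-comm)
  open import Data.Vec using (Vec)
  open import Data.List using ([]; _∷_)
  open import Data.Product using (∃; _×_; _,_; proj₁; proj₂)
  open import Data.Unit using (tt)
  open import Relation.Binary.PropositionalEquality
  open import Data.Nat.Tactic.RingSolver
  open Counting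
  open PowerEstimates
  open RandomLabellings
  open Parameters
  open ≤-Reasoning

  <ᵇ≡true⇒< : ∀ {x y} → (x <ᵇ y) ≡ true → x < y
  <ᵇ≡true⇒< {x} {y} eq = <ᵇ⇒< x y (subst T (sym eq) tt)

  <ᵇ≡false⇒≥ : ∀ {x y} → (x <ᵇ y) ≡ false → y ≤ x
  <ᵇ≡false⇒≥ eq = ≮⇒≥ (λ x<y → subst T eq (<⇒<ᵇ x<y))

  <⇒<ᵇ≡true : ∀ {x y} → x < y → (x <ᵇ y) ≡ true
  <⇒<ᵇ≡true {x} {y} x<y with x <ᵇ y | <⇒<ᵇ x<y
  ... | true | _ = refl

  𝟙≡0⇒≡false : ∀ {b} → 𝟙 b ≡ 0 → b ≡ false
  𝟙≡0⇒≡false {false} _ = refl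

  ∩-swap : ∀ {n} (p q r : Subset n) → (p ∩ q) ∩ r ≡ (p ∩ r) ∩ q
  ∩-swap p q r = trans (∩-assoc p q r) (trans (cong (p ∩_) (∩-comm q r)) (sym (∩-assoc p r q)))

  record Selected {n m : ℕ} (P Q s : ℕ) (B : Subset n) (V : Fin m → Subset n)
                  (N : Fin n → Subset n) (A : Subset n) : Set where
    field
      A⊆∁B          : A ⊆ ∁ B
      Pn≤2Q∣A∣       : P * n ≤ 2 * Q * ∣ A ∣
      Q∣A∣≤2Pn       : Q * ∣ A ∣ ≤ 2 * P * n
      Q∣A∩Vᵢ∣≤2Ps    : ∀ i → Q * ∣ A ∩ V i ∣ ≤ 2 * P * s
      P∣Vᵢ∩Nᵥ∣≤2Q∣A∩Vᵢ∩Nᵥ∣ : ∀ v i → 30 * P * s < ∣ V i ∩ N v ∣ * Q →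
                            P * ∣ V i ∩ N v ∣ ≤ 2 * Q * ∣ (A ∩ V i) ∩ N v ∣
      Pn≤50Q∣A∩Nᵥ∣   : ∀ v → n < 40 * ∣ ∁ B ∩ N v ∣ → P * n ≤ 50 * Q * ∣ A ∩ N v ∣

  module Selection {n m s b₀ P Q w′ L h : ℕ} (constraints : Constraints n m s b₀ P Q (suc w′) L h)
    (B : Subset n) (V : Fin m → Subset n) (∣Vᵢ∣≡s : ∀ i → ∣ V i ∣ ≡ s)
    (∣B∩Vᵢ∣Q≤10Ps : ∀ i → ∣ B ∩ V i ∣ * Q ≤ 10 * P * s)
    (∣B∣Q≤b₀Q+10Pms : ∣ B ∣ * Q ≤ b₀ * Q + 10 * P * (m * s))
    (N : Fin n → Subset n) where

    open Constraints constraints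
    open ParameterArithmetic constraints
    -- 1 + (7 + 8w′) = 8w labels
    open Labellings (7 + 8 * w′)

    w = suc w′
    U = ∁ B

    16w-1≡1+2t′ : 15 + 16 * w′ ≡ 1 + (7 + 8 * w′) * 2
    16w-1≡1+2t′ = solve (w′ ∷ [])

    16w+1≡3+2t′ : 17 + 16 * w′ ≡ 3 + (7 + 8 * w′) * 2
    16w+1≡3+2t′ = solve (w′ ∷ [])

    16w≡2t : 16 + 16 * w′ ≡ 2 * t
    16w≡2t = expand w′
      where
      expand : ∀ w′ → 16 + 16 * w′ ≡ 2 * (1 + (7 + 8 * w′))
      expand = solve-∀

    lowerEvent : ∀ (S : Subset n) c R .{{_ : NonZero c}} →
      (∀ k → c * Q * k ≤ P * R → 12 * (k + h) * w ≤ ∣ S ∣) →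
      Rare h 1 (λ z → 𝟙 (c * Q * ∣ S ∩ chosen z ∣ <ᵇ P * R))
    lowerEvent S c R {{c≢0}} large = lowerTail h S _ k bad⇒≤k moment
      where
      instance
        cQ≢0 : NonZero (c * Q)
        cQ≢0 = m*n≢0 c Q
      k = P * R / (c * Q)
      kcQ≤PR : c * Q * k ≤ P * R
      kcQ≤PR = subst (_≤ P * R) (*-comm k (c * Q)) (m/n*n≤m (P * R) (c * Q))
      bad⇒≤k : ∀ X → (c * Q * X <ᵇ P * R) ≡ true → X ≤ k
      bad⇒≤k X bad = s≤s⁻¹ (*-cancelʳ-< (c * Q) X (suc k) (begin-strict
        X * (c * Q)        ≡⟨ *-comm X (c * Q) ⟩
        c * Q * X          <⟨ <ᵇ≡true⇒< bad ⟩
        P * R              <⟨ m<[1+m/n]*n (P * R) (c * Q) ⟩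
        suc k * (c * Q)    ∎))
      moment : 2 ^ k * 2 ^ h * (1 + (7 + 8 * w′) * 2) ^ ∣ S ∣ ≤ (2 * t) ^ ∣ S ∣
      moment = subst₂ (λ a b → 2 ^ k * 2 ^ h * a ^ ∣ S ∣ ≤ b ^ ∣ S ∣)
        16w-1≡1+2t′ 16w≡2t (2^k*2^h*[16w-1]^D≤[16w]^D w′ k h ∣ S ∣ (large k kcQ≤PR))

    upperEvent : ∀ (S : Subset n) R → ∣ S ∣ ≤ R → 990 * L * Q < P * R →
      Rare h 1 (λ z → 𝟙 (2 * P * R <ᵇ Q * ∣ S ∩ chosen z ∣))
    upperEvent S R ∣S∣≤R 990LQ<PR = upperTail h S _ k bad⇒k≤ moment
      where
      k = suc (2 * P * R / Q)
      q = R / w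
      2PR<Qk : 2 * P * R < Q * k
      2PR<Qk = subst (2 * P * R <_) (*-comm k Q) (m<[1+m/n]*n (2 * P * R) Q)
      bad⇒k≤ : ∀ X → (2 * P * R <ᵇ Q * X) ≡ true → k ≤ X
      bad⇒k≤ X bad = *-cancelʳ-< Q (2 * P * R / Q) X (begin-strict
        2 * P * R / Q * Q   ≤⟨ m/n*n≤m (2 * P * R) Q ⟩
        2 * P * R           <⟨ <ᵇ≡true⇒< bad ⟩
        Q * X               ≡⟨ *-comm Q X ⟩
        X * Q               ∎)
      conditions = upperTail-condition R k q 990LQ<PR 2PR<Qk (m/n*n≤m R w)
      ∣S∣≤[1+q]w : ∣ S ∣ ≤ suc q * w
      ∣S∣≤[1+q]w = ≤-trans ∣S∣≤R (<⇒≤ (m<[1+m/n]*n R w))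
      moment : 2 ^ k * 2 ^ h * (3 + (7 + 8 * w′) * 2) ^ ∣ S ∣ ≤ 3 ^ k * (2 * t) ^ ∣ S ∣
      moment = subst₂ (λ a b → 2 ^ k * 2 ^ h * a ^ ∣ S ∣ ≤ 3 ^ k * b ^ ∣ S ∣)
        16w+1≡3+2t′ 16w≡2t
        (2^k*2^h*[16w+1]^D≤3^k*[16w]^D w′ k h ∣ S ∣ (suc q) ∣S∣≤[1+q]w (proj₂ conditions) (proj₁ conditions))

    tooFew tooMany : Vec (Fin t) n → Bool
    tooFew  z = 2 * Q * ∣ U ∩ chosen z ∣ <ᵇ P * n
    tooMany z = 2 * P * n <ᵇ Q * ∣ U ∩ chosen z ∣

    tooManyIn : Fin m → Vec (Fin t) n → Bool
    tooManyIn i z = 2 * P * s <ᵇ Q * ∣ (U ∩ V i) ∩ chosen z ∣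

    deg : Fin n → Fin m → ℕ
    deg v i = ∣ V i ∩ N v ∣

    heavy : Fin n → Fin m → Bool
    heavy v i = 30 * P * s <ᵇ deg v i * Q

    fewNeighboursIn : Fin n → Fin m → Vec (Fin t) n → Bool
    fewNeighboursIn v i z = 2 * Q * ∣ (U ∩ (V i ∩ N v)) ∩ chosen z ∣ <ᵇ P * deg v i

    dense : Fin n → Bool
    dense v = n <ᵇ 40 * ∣ U ∩ N v ∣

    fewNeighbours : Fin n → Vec (Fin t) n → Bool
    fewNeighbours v z = 50 * Q * ∣ (U ∩ N v) ∩ chosen z ∣ <ᵇ P * n

    bad : Vec (Fin t) n → ℕ
    bad z = 𝟙 (tooFew z) + 𝟙 (tooMany z) + ∑[ i < m ] 𝟙 (tooManyIn i z)
          + ∑[ v < n ] ∑[ i < m ] 𝟙 (heavy v i ∧ fewNeighboursIn v i z)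
          + ∑[ v < n ] 𝟙 (dense v ∧ fewNeighbours v z)

    rare-bad : Rare h (1 + 1 + m * 1 + n * (m * 1) + n * 1) bad
    rare-bad =
      rare-+ h (rare-+ h (rare-+ h (rare-+ h rare-tooFew rare-tooMany)
                                   (rare-∑ h (λ i z → 𝟙 (tooManyIn i z)) rare-tooManyIn))
                         (rare-∑ h (λ v z → ∑[ i < m ] 𝟙 (heavy v i ∧ fewNeighboursIn v i z)) λ v →
                            rare-∑ h (λ i z → 𝟙 (heavy v i ∧ fewNeighboursIn v i z)) (rare-fewNeighboursIn v)))
               (rare-∑ h (λ v z → 𝟙 (dense v ∧ fewNeighbours v z)) rare-fewNeighbours)
      where
      rare-tooFew : Rare h 1 (λ z → 𝟙 (tooFew z))
      rare-tooFew = lowerEvent U 2 n λ k →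
        lowerTail-large k ∣ U ∣ ∣ B ∣ ∣∁B∣+∣B∣≡n (5B≤n ∣ B ∣ ∣B∣Q≤b₀Q+10Pms)
        where
        ∣∁B∣+∣B∣≡n : ∣ U ∣ + ∣ B ∣ ≡ n
        ∣∁B∣+∣B∣≡n = trans (cong (_+ ∣ B ∣) (∣∁p∣≡n∸∣p∣ B)) (m∸n+n≡m (∣p∣≤n B))
      rare-tooMany : Rare h 1 (λ z → 𝟙 (tooMany z))
      rare-tooMany = upperEvent U n (∣p∣≤n U) 990LQ<Pn
      rare-tooManyIn : ∀ i → Rare h 1 (λ z → 𝟙 (tooManyIn i z))
      rare-tooManyIn i =
        upperEvent (U ∩ V i) s (≤-trans (∣p∩q∣≤∣q∣ U (V i)) (≤-reflexive (∣Vᵢ∣≡s i))) 990LQ<Ps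
      rare-fewNeighboursIn : ∀ v i → Rare h 1 (λ z → 𝟙 (heavy v i ∧ fewNeighboursIn v i z))
      rare-fewNeighboursIn v i = rare-guarded h (heavy v i) (fewNeighboursIn v i) λ active →
        lowerEvent (U ∩ (V i ∩ N v)) 2 (deg v i) λ k →
          lowerTail-inPart k _ (deg v i) ∣ B ∩ V i ∣ (∣p∩q∣≤∣∁r∩p∩q∣+∣r∩p∣ (V i) (N v) B)
                           (∣B∩Vᵢ∣Q≤10Ps i) (<ᵇ≡true⇒< active)
      rare-fewNeighbours : ∀ v → Rare h 1 (λ z → 𝟙 (dense v ∧ fewNeighbours v z))
      rare-fewNeighbours v = rare-guarded h (dense v) (fewNeighbours v) λ active →
        lowerEvent (U ∩ N v) 50 n λ k → lowerTail-dense k _ (<ᵇ≡true⇒< active)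

    module _ (z : Vec (Fin t) n) (bad≡0 : bad z ≡ 0) where

      private
        +≡0 : ∀ {a b} → a + b ≡ 0 → a ≡ 0 × b ≡ 0
        +≡0 {a} a+b≡0 = m+n≡0⇒m≡0 a a+b≡0 , m+n≡0⇒n≡0 a a+b≡0

        true∧≡false : ∀ {a b} → a ≡ true → a ∧ b ≡ false → b ≡ false
        true∧≡false refl b≡false = b≡false

        A = U ∩ chosen z

        parts₁ : 𝟙 (tooFew z) + 𝟙 (tooMany z) + ∑[ i < m ] 𝟙 (tooManyIn i z)
                 + ∑[ v < n ] ∑[ i < m ] 𝟙 (heavy v i ∧ fewNeighboursIn v i z) ≡ 0
               × ∑[ v < n ] 𝟙 (dense v ∧ fewNeighbours v z) ≡ 0
        parts₁ = +≡0 bad≡0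

        parts₂ : 𝟙 (tooFew z) + 𝟙 (tooMany z) + ∑[ i < m ] 𝟙 (tooManyIn i z) ≡ 0
               × ∑[ v < n ] ∑[ i < m ] 𝟙 (heavy v i ∧ fewNeighboursIn v i z) ≡ 0
        parts₂ = +≡0 (proj₁ parts₁)

        parts₃ : 𝟙 (tooFew z) + 𝟙 (tooMany z) ≡ 0 × ∑[ i < m ] 𝟙 (tooManyIn i z) ≡ 0
        parts₃ = +≡0 (proj₁ parts₂)

        parts₄ : 𝟙 (tooFew z) ≡ 0 × 𝟙 (tooMany z) ≡ 0
        parts₄ = +≡0 (proj₁ parts₃)

        notTooFew : tooFew z ≡ false
        notTooFew = 𝟙≡0⇒≡false (proj₁ parts₄)

        notTooMany : tooMany z ≡ false
        notTooMany = 𝟙≡0⇒≡false (proj₂ parts₄)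

        notTooManyIn : ∀ i → tooManyIn i z ≡ false
        notTooManyIn i = 𝟙≡0⇒≡false (∑≡0⇒≡0 (λ i → 𝟙 (tooManyIn i z)) (proj₂ parts₃) i)

        notFewNeighboursIn : ∀ v i → heavy v i ∧ fewNeighboursIn v i z ≡ false
        notFewNeighboursIn v i = 𝟙≡0⇒≡false
          (∑≡0⇒≡0 (λ i → 𝟙 (heavy v i ∧ fewNeighboursIn v i z))
            (∑≡0⇒≡0 (λ v → ∑[ i < m ] 𝟙 (heavy v i ∧ fewNeighboursIn v i z)) (proj₂ parts₂) v) i)

        notFewNeighbours : ∀ v → dense v ∧ fewNeighbours v z ≡ false
        notFewNeighbours v = 𝟙≡0⇒≡false (∑≡0⇒≡0 (λ v → 𝟙 (dense v ∧ fewNeighbours v z)) (proj₂ parts₁) v)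

        U∩Vᵢ∩Nᵥ∩Z≡ : ∀ v i → (U ∩ (V i ∩ N v)) ∩ chosen z ≡ (A ∩ V i) ∩ N v
        U∩Vᵢ∩Nᵥ∩Z≡ v i = trans (cong (_∩ chosen z) (sym (∩-assoc U (V i) (N v))))
          (trans (∩-swap (U ∩ V i) (N v) (chosen z)) (cong (_∩ N v) (∩-swap U (V i) (chosen z))))

      goodSelection : Selected P Q s B V N (U ∩ chosen z)
      goodSelection = record
        { A⊆∁B                 = p∩q⊆p U (chosen z)
        ; Pn≤2Q∣A∣              = <ᵇ≡false⇒≥ notTooFew
        ; Q∣A∣≤2Pn              = <ᵇ≡false⇒≥ notTooMany
        ; Q∣A∩Vᵢ∣≤2Ps           = Q∣A∩Vᵢ∣≤2Ps
        ; P∣Vᵢ∩Nᵥ∣≤2Q∣A∩Vᵢ∩Nᵥ∣ = P∣Vᵢ∩Nᵥ∣≤2Q∣A∩Vᵢ∩Nᵥ∣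
        ; Pn≤50Q∣A∩Nᵥ∣          = Pn≤50Q∣A∩Nᵥ∣
        }
        where
        Q∣A∩Vᵢ∣≤2Ps : ∀ i → Q * ∣ A ∩ V i ∣ ≤ 2 * P * s
        Q∣A∩Vᵢ∣≤2Ps i =
          subst (λ X → Q * ∣ X ∣ ≤ 2 * P * s) (∩-swap U (V i) (chosen z)) (<ᵇ≡false⇒≥ (notTooManyIn i))
        P∣Vᵢ∩Nᵥ∣≤2Q∣A∩Vᵢ∩Nᵥ∣ : ∀ v i → 30 * P * s < deg v i * Q → P * deg v i ≤ 2 * Q * ∣ (A ∩ V i) ∩ N v ∣
        P∣Vᵢ∩Nᵥ∣≤2Q∣A∩Vᵢ∩Nᵥ∣ v i 30Ps<degQ = subst (λ X → P * deg v i ≤ 2 * Q * ∣ X ∣) (U∩Vᵢ∩Nᵥ∩Z≡ v i)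
          (<ᵇ≡false⇒≥ (true∧≡false (<⇒<ᵇ≡true 30Ps<degQ) (notFewNeighboursIn v i)))
        Pn≤50Q∣A∩Nᵥ∣ : ∀ v → n < 40 * ∣ U ∩ N v ∣ → P * n ≤ 50 * Q * ∣ A ∩ N v ∣
        Pn≤50Q∣A∩Nᵥ∣ v n<40∣U∩Nᵥ∣ = subst (λ X → P * n ≤ 50 * Q * ∣ X ∣) (∩-swap U (N v) (chosen z))
          (<ᵇ≡false⇒≥ (true∧≡false (<⇒<ᵇ≡true n<40∣U∩Nᵥ∣) (notFewNeighbours v)))

    good : ∃ λ z → bad z ≡ 0
    good = rare⇒∃≡0 h bad rare-bad #events<2^h

    selection : ∃ (Selected P Q s B V N)
    selection = U ∩ chosen (proj₁ good) , goodSelection (proj₁ good) (proj₂ good)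

module RationalBounds where

  open import Data.Nat as ℕ using (ℕ; suc)
  open import Data.Nat.Properties as ℕ using (module ≤-Reasoning)
  open import Data.Integer using (+_)
  open import Data.Rational using (ℚ; _/_; 1ℚ; _*_; _≤_; _<_)
  open import Data.List using ([]; _∷_)
  open import Relation.Binary.PropositionalEquality
  open import Data.Nat.Tactic.RingSolver
  open import Defs using (ℕ→ℚ)
  open Fractions
  open ≤-Reasoning

  module _ {p : ℚ} {P q : ℕ} (p≐ : p ≐ P ÷ suc q) where

    p<1/100⇒100P<Q : p < + 1 / 100 → 100 ℕ.* P ℕ.< suc q
    p<1/100⇒100P<Q p<1/100 = begin-strict
      100 ℕ.* P      ≡⟨ ℕ.*-comm 100 P ⟩
      P ℕ.* 100      <⟨ ≐-<⇒ p≐ (+[u]/d≐u÷d 1 99) p<1/100 ⟩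
      1 ℕ.* suc q    ≡⟨ ℕ.*-identityˡ (suc q) ⟩
      suc q          ∎

    x≤10py⇒xQ≤10Py : ∀ x y → ℕ→ℚ x ≤ (+ 10 / 1) * p * ℕ→ℚ y → x ℕ.* suc q ℕ.≤ 10 ℕ.* P ℕ.* y
    x≤10py⇒xQ≤10Py x y x≤10py = begin
      x ℕ.* suc q                   ≡⟨ solve (x ∷ q ∷ []) ⟩
      x ℕ.* (1 ℕ.* suc q ℕ.* 1)     ≤⟨ ≐-≤⇒ (ℕ→ℚ≐÷1 x) (≐-* (≐-* (ℕ→ℚ≐÷1 10) p≐) (ℕ→ℚ≐÷1 y)) x≤10py ⟩
      10 ℕ.* P ℕ.* y ℕ.* 1          ≡⟨ ℕ.*-identityʳ _ ⟩
      10 ℕ.* P ℕ.* y                ∎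

    30py<x⇒30Py<xQ : ∀ x y → (+ 30 / 1) * p * ℕ→ℚ y < ℕ→ℚ x → 30 ℕ.* P ℕ.* y ℕ.< x ℕ.* suc q
    30py<x⇒30Py<xQ x y 30py<x = begin-strict
      30 ℕ.* P ℕ.* y                ≡⟨ ℕ.*-identityʳ _ ⟨
      30 ℕ.* P ℕ.* y ℕ.* 1          <⟨ ≐-<⇒ (≐-* (≐-* (ℕ→ℚ≐÷1 30) p≐) (ℕ→ℚ≐÷1 y)) (ℕ→ℚ≐÷1 x) 30py<x ⟩
      x ℕ.* (1 ℕ.* suc q ℕ.* 1)     ≡⟨ solve (x ∷ q ∷ []) ⟩
      x ℕ.* suc q                   ∎

    Px≤2Qy⇒px/2≤y : ∀ x y → P ℕ.* x ℕ.≤ 2 ℕ.* suc q ℕ.* y → p * (+ 1 / 2) * ℕ→ℚ x ≤ ℕ→ℚ y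
    Px≤2Qy⇒px/2≤y x y Px≤2Qy = ≐-≤⇐ (≐-* (≐-* p≐ (+[u]/d≐u÷d 1 1)) (ℕ→ℚ≐÷1 x)) (ℕ→ℚ≐÷1 y) (begin
      P ℕ.* 1 ℕ.* x ℕ.* 1          ≡⟨ solve (P ∷ x ∷ []) ⟩
      P ℕ.* x                      ≤⟨ Px≤2Qy ⟩
      2 ℕ.* suc q ℕ.* y            ≡⟨ solve (q ∷ y ∷ []) ⟩
      y ℕ.* (suc q ℕ.* 2 ℕ.* 1)    ∎)

    Qx≤2Py⇒x≤2py : ∀ x y → suc q ℕ.* x ℕ.≤ 2 ℕ.* P ℕ.* y → ℕ→ℚ x ≤ (+ 2 / 1) * p * ℕ→ℚ y
    Qx≤2Py⇒x≤2py x y Qx≤2Py = ≐-≤⇐ (ℕ→ℚ≐÷1 x) (≐-* (≐-* (ℕ→ℚ≐÷1 2) p≐) (ℕ→ℚ≐÷1 y)) (begin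
      x ℕ.* (1 ℕ.* suc q ℕ.* 1)    ≡⟨ solve (x ∷ q ∷ []) ⟩
      suc q ℕ.* x                  ≤⟨ Qx≤2Py ⟩
      2 ℕ.* P ℕ.* y                ≡⟨ ℕ.*-identityʳ _ ⟨
      2 ℕ.* P ℕ.* y ℕ.* 1          ∎)

    am²<p²n⇒ : ∀ {a N D} → a ≐ N ÷ suc D → ∀ m n → (a * ℕ→ℚ m) * (a * ℕ→ℚ m) < p * p * ℕ→ℚ n →
      N ℕ.* m ℕ.* (N ℕ.* m) ℕ.* (suc q ℕ.* suc q) ℕ.< P ℕ.* P ℕ.* n ℕ.* (suc D ℕ.* suc D)
    am²<p²n⇒ {a} {N} {D} a≐ m n am²<p²n = begin-strict
      N ℕ.* m ℕ.* (N ℕ.* m) ℕ.* (suc q ℕ.* suc q)            ≡⟨ solve (N ∷ m ∷ q ∷ []) ⟩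
      N ℕ.* m ℕ.* (N ℕ.* m) ℕ.* (suc q ℕ.* suc q ℕ.* 1)      <⟨ ≐-<⇒ (≐-* am≐ am≐) (≐-* (≐-* p≐ p≐) (ℕ→ℚ≐÷1 n)) am²<p²n ⟩
      P ℕ.* P ℕ.* n ℕ.* (suc D ℕ.* 1 ℕ.* (suc D ℕ.* 1))      ≡⟨ solve (P ∷ n ∷ D ∷ []) ⟩
      P ℕ.* P ℕ.* n ℕ.* (suc D ℕ.* suc D)                    ∎
      where
      am≐ = ≐-* a≐ (ℕ→ℚ≐÷1 m)

  module _ {ε : ℚ} {E e : ℕ} (ε≐ : ε ≐ E ÷ suc e) where

    ε<1/10⇒10E<E′ : ε < + 1 / 10 → 10 ℕ.* E ℕ.< suc e
    ε<1/10⇒10E<E′ ε<1/10 = begin-strict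
      10 ℕ.* E       ≡⟨ ℕ.*-comm 10 E ⟩
      E ℕ.* 10       <⟨ ≐-<⇒ ε≐ (+[u]/d≐u÷d 1 9) ε<1/10 ⟩
      1 ℕ.* suc e    ≡⟨ ℕ.*-identityˡ (suc e) ⟩
      suc e          ∎

    1≤εm⇒E′≤Em : ∀ m → 1ℚ ≤ ε * ℕ→ℚ m → suc e ℕ.≤ E ℕ.* m
    1≤εm⇒E′≤Em m 1≤εm = begin
      suc e                 ≡⟨ solve (e ∷ []) ⟩
      1 ℕ.* (suc e ℕ.* 1)   ≤⟨ ≐-≤⇒ (ℕ→ℚ≐÷1 1) (≐-* ε≐ (ℕ→ℚ≐÷1 m)) 1≤εm ⟩
      E ℕ.* m ℕ.* 1         ≡⟨ ℕ.*-identityʳ _ ⟩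
      E ℕ.* m               ∎

    x≤εn⇒xE′≤En : ∀ x n → ℕ→ℚ x ≤ ε * ℕ→ℚ n → x ℕ.* suc e ℕ.≤ E ℕ.* n
    x≤εn⇒xE′≤En x n x≤εn = begin
      x ℕ.* suc e           ≡⟨ solve (x ∷ e ∷ []) ⟩
      x ℕ.* (suc e ℕ.* 1)   ≤⟨ ≐-≤⇒ (ℕ→ℚ≐÷1 x) (≐-* ε≐ (ℕ→ℚ≐÷1 n)) x≤εn ⟩
      E ℕ.* n ℕ.* 1         ≡⟨ ℕ.*-identityʳ _ ⟩
      E ℕ.* n               ∎

  n/40<x⇒n<40x : ∀ n x → ℕ→ℚ n * (+ 1 / 40) < ℕ→ℚ x → n ℕ.< 40 ℕ.* x
  n/40<x⇒n<40x n x n/40<x = begin-strict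
    n                     ≡⟨ solve (n ∷ []) ⟩
    n ℕ.* 1 ℕ.* 1         <⟨ ≐-<⇒ (≐-* (ℕ→ℚ≐÷1 n) (+[u]/d≐u÷d 1 39)) (ℕ→ℚ≐÷1 x) n/40<x ⟩
    x ℕ.* (1 ℕ.* 40)      ≡⟨ solve (x ∷ []) ⟩
    40 ℕ.* x              ∎

  y≤100x⇒y/100≤x : ∀ y x → y ℕ.≤ 100 ℕ.* x → ℕ→ℚ y * (+ 1 / 100) ≤ ℕ→ℚ x
  y≤100x⇒y/100≤x y x y≤100x = ≐-≤⇐ (≐-* (ℕ→ℚ≐÷1 y) (+[u]/d≐u÷d 1 99)) (ℕ→ℚ≐÷1 x) (begin
    y ℕ.* 1 ℕ.* 1         ≡⟨ solve (y ∷ []) ⟩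
    y                     ≤⟨ y≤100x ⟩
    100 ℕ.* x             ≡⟨ solve (x ∷ []) ⟩
    x ℕ.* (1 ℕ.* 100)     ∎)

module Reduction where

  open import Data.Nat as ℕ using (ℕ; suc; zero; z≤n; s≤s; NonZero; >-nonZero; >-nonZero⁻¹)
  import Data.Nat.Properties as ℕ
  open import Data.Nat.DivMod using (m/n*n≤m; m≥n⇒m/n>0)
  open import Data.Integer using (+_)
  open import Data.Fin using (Fin; zero; suc; fromℕ<)
  open import Data.Fin.Subset using (Subset; _⊆_; _∩_; ∁; ∣_∣)
  open import Data.Fin.Subset.Properties using (∣p∩q∣≤∣q∣)
  open import Data.Rational using (ℚ; _/_; 0ℚ; _*_; _≤_; _<_)
  open import Data.Product using (_×_; ∃; ∃-syntax; _,_; proj₁; proj₂; map₂)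
  open import Data.List using ([]; _∷_)
  open import Function using (_∘_)
  open import Relation.Binary.PropositionalEquality
  open import Data.Nat.Tactic.RingSolver
  open import Defs hiding (sym)
  open Counting
  open Fractions
  open ExponentialSeries
  open Parameters
  open LogarithmicBounds
  open RandomSelection
  open RationalBounds
  open import Algebra.Properties.CommutativeSemigroup ℕ.*-commutativeSemigroup using (x∙yz≈y∙xz)
  open ℕ.≤-Reasoning

  quotient-bounds : ∀ m n .{{_ : NonZero n}} → n ℕ.≤ m → ∃ λ k → suc k ℕ.* n ℕ.≤ m × m ℕ.< suc (suc k) ℕ.* n
  quotient-bounds m n n≤m with m ℕ./ n | m/n*n≤m m n | m<[1+m/n]*n m n | m≥n⇒m/n>0 n≤m
  ... | suc k | lower | upper | _ = k , lower , upper

  scale : ∀ P Q .{{_ : NonZero P}} → 100 ℕ.* P ℕ.< Q →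
          ∃ λ w′ → 10 ℕ.* P ℕ.* suc w′ ℕ.≤ Q × Q ℕ.< 10 ℕ.* P ℕ.* suc (suc w′)
  scale P Q 100P<Q with quotient-bounds Q (10 ℕ.* P) {{ℕ.m*n≢0 10 P}} 10P≤Q
    where
    10P≤Q = ℕ.≤-trans (ℕ.*-monoˡ-≤ P (ℕ.≤ᵇ⇒≤ 10 100 _)) (ℕ.<⇒≤ 100P<Q)
  ... | w′ , lower , upper = w′ , subst (ℕ._≤ Q) (ℕ.*-comm (suc w′) (10 ℕ.* P)) lower
                                , subst (Q ℕ.<_) (ℕ.*-comm (suc (suc w′)) (10 ℕ.* P)) upper

  logCondition⇒ : ∀ {n m p P q} → p ≐ P ÷ suc q → LogCondition n m p →
    ∃ λ A → A ℕ.* A ℕ.* (m ℕ.* m) ℕ.* (suc q ℕ.* suc q) ℕ.< P ℕ.* P ℕ.* n × n ℕ.< expBound (suc A)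
  logCondition⇒ {n} {m} {p} {P} {q} p≐ (a , 0<a , am²<p²n , K , n<expSum) with positive⇒≐ a 0<a
  ... | u , v , a≐ = A , A²m²Q²<P²n , <expSum⇒<expBound a≐ (suc A) (ℕ.<⇒≤ (m<[1+m/n]*n N D)) n K n<expSum
    where
    N = suc u
    D = suc v
    A = N ℕ./ D
    A²m²Q²<P²n : A ℕ.* A ℕ.* (m ℕ.* m) ℕ.* (suc q ℕ.* suc q) ℕ.< P ℕ.* P ℕ.* n
    A²m²Q²<P²n = ℕ.*-cancelʳ-< (D ℕ.* D) _ _ (begin-strict
      A ℕ.* A ℕ.* (m ℕ.* m) ℕ.* (suc q ℕ.* suc q) ℕ.* (D ℕ.* D)
        ≡⟨ regroup A m (suc q) D ⟩
      A ℕ.* D ℕ.* m ℕ.* (A ℕ.* D ℕ.* m) ℕ.* (suc q ℕ.* suc q)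
        ≤⟨ ℕ.*-monoˡ-≤ (suc q ℕ.* suc q) (ℕ.*-mono-≤ (ℕ.*-monoˡ-≤ m AD≤N) (ℕ.*-monoˡ-≤ m AD≤N)) ⟩
      N ℕ.* m ℕ.* (N ℕ.* m) ℕ.* (suc q ℕ.* suc q)
        <⟨ am²<p²n⇒ p≐ a≐ m n am²<p²n ⟩
      P ℕ.* P ℕ.* n ℕ.* (D ℕ.* D) ∎)
      where
      AD≤N = m/n*n≤m N D
      regroup : ∀ a m Q D → a ℕ.* a ℕ.* (m ℕ.* m) ℕ.* (Q ℕ.* Q) ℕ.* (D ℕ.* D)
                          ≡ a ℕ.* D ℕ.* m ℕ.* (a ℕ.* D ℕ.* m) ℕ.* (Q ℕ.* Q)
      regroup = solve-∀

  1≤m*n⇒1≤n : ∀ m n → 1 ℕ.≤ m ℕ.* n → 1 ℕ.≤ n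
  1≤m*n⇒1≤n m n 1≤mn = >-nonZero⁻¹ n {{ℕ.m*n≢0⇒n≢0 m {{>-nonZero 1≤mn}}}}

  module PartitionSizes {n r : ℕ} {G : Graph n} {c : Fin n → Fin n → Fin r} {ε d : ℚ} {m : ℕ}
    {V : Fin (suc m) → Subset n} {G′ : Graph n} (regular : IsRegularPartition G c ε d m V G′)
    {E e : ℕ} (ε≐ : ε ≐ E ÷ suc e) (10E<E′ : 10 ℕ.* E ℕ.< suc e) where

    open IsRegularPartition regular

    E′≤Em : suc e ℕ.≤ E ℕ.* m
    E′≤Em = 1≤εm⇒E′≤Em ε≐ m mBig

    11≤m : 11 ℕ.≤ m
    11≤m = ℕ.*-cancelˡ-< E 10 m (ℕ.<-≤-trans (subst (ℕ._< suc e) (ℕ.*-comm 10 E) 10E<E′) E′≤Em)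

    instance
      E≢0 : NonZero E
      E≢0 = ℕ.m*n≢0⇒m≢0 E {{ℕ.≢-nonZero (ℕ.m<n⇒n≢0 (ℕ.<-≤-trans (s≤s z≤n) E′≤Em))}}

    10x≤n : ∀ x → ℕ→ℚ x ≤ ε * ℕ→ℚ n → 10 ℕ.* x ℕ.≤ n
    10x≤n x x≤εn = ℕ.*-cancelˡ-≤ E (begin
      E ℕ.* (10 ℕ.* x)   ≡⟨ solve (E ∷ x ∷ []) ⟩
      10 ℕ.* E ℕ.* x     ≤⟨ ℕ.*-monoˡ-≤ x (ℕ.<⇒≤ 10E<E′) ⟩
      suc e ℕ.* x        ≡⟨ ℕ.*-comm (suc e) x ⟩
      x ℕ.* suc e        ≤⟨ x≤εn⇒xE′≤En ε≐ x n x≤εn ⟩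
      E ℕ.* n            ∎)

    b₀ = ∣ V zero ∣
    -- the common size of V₁, …, Vₘ, read off V₁, which exists as m ≥ 11
    s = ∣ V (suc (fromℕ< (ℕ.<-trans (s≤s z≤n) 11≤m))) ∣

    ∣Vᵢ∣≡s : ∀ i → ∣ V (suc i) ∣ ≡ s
    ∣Vᵢ∣≡s i = equal i _

    ∑∣Vᵢ∣≡ms : ∑[ i < m ] ∣ V (suc i) ∣ ≡ m ℕ.* s
    ∑∣Vᵢ∣≡ms = trans (sum-cong-≗ ∣Vᵢ∣≡s) (∑-const m s)

    10b₀≤n : 10 ℕ.* b₀ ℕ.≤ n
    10b₀≤n = 10x≤n b₀ V₀small

    n≤b₀+ms : n ℕ.≤ b₀ ℕ.+ m ℕ.* s
    n≤b₀+ms = subst (n ℕ.≤_) (cong (b₀ ℕ.+_) ∑∣Vᵢ∣≡ms) (n≤∑∣Fᵢ∣ V cover)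

    ms≤n : m ℕ.* s ℕ.≤ n
    ms≤n = ℕ.≤-trans (ℕ.m≤n+m (m ℕ.* s) b₀)
             (subst (ℕ._≤ n) (cong (b₀ ℕ.+_) ∑∣Vᵢ∣≡ms) (∑∣Fᵢ∣≤n V (λ u i j → disjoint i j u)))

    module _ (1≤n : 1 ℕ.≤ n) where

      1≤s : 1 ℕ.≤ s
      1≤s = 1≤m*n⇒1≤n (10 ℕ.* m) s (ℕ.≤-trans (ℕ.≤-trans 1≤n (ℕ.m≤n*m n 9))
              (ℕ.≤-trans (9n≤10ms {m = m} {s} 10b₀≤n n≤b₀+ms) (ℕ.≤-reflexive (sym (ℕ.*-assoc 10 m s)))))

      m≤n : m ℕ.≤ n
      m≤n = ℕ.≤-trans (ℕ.≤-trans (ℕ.≤-reflexive (sym (ℕ.*-identityʳ m))) (ℕ.*-monoʳ-≤ m 1≤s)) ms≤n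

      10≤n : 10 ℕ.≤ n
      10≤n = ℕ.≤-trans (ℕ.*-monoʳ-≤ 10 1≤s) (10x≤n s (Vismall _))

    module _ (B : Subset n) (P Q : ℕ) (∣B∩Vᵢ∣Q≤10Ps : ∀ i → ∣ B ∩ V (suc i) ∣ ℕ.* Q ℕ.≤ 10 ℕ.* P ℕ.* s) where

      ∣B∣Q≤b₀Q+10Pms : ∣ B ∣ ℕ.* Q ℕ.≤ b₀ ℕ.* Q ℕ.+ 10 ℕ.* P ℕ.* (m ℕ.* s)
      ∣B∣Q≤b₀Q+10Pms = begin
        ∣ B ∣ ℕ.* Q
          ≤⟨ ℕ.*-monoˡ-≤ Q (∣p∣≤∑∣p∩Fᵢ∣ B V (λ u _ → cover u)) ⟩
        (∣ B ∩ V zero ∣ ℕ.+ ∑[ i < m ] ∣ B ∩ V (suc i) ∣) ℕ.* Q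
          ≡⟨ ℕ.*-distribʳ-+ Q ∣ B ∩ V zero ∣ _ ⟩
        ∣ B ∩ V zero ∣ ℕ.* Q ℕ.+ (∑[ i < m ] ∣ B ∩ V (suc i) ∣) ℕ.* Q
          ≡⟨ cong (∣ B ∩ V zero ∣ ℕ.* Q ℕ.+_) (∑-distribʳ-* Q (λ i → ∣ B ∩ V (suc i) ∣)) ⟨
        ∣ B ∩ V zero ∣ ℕ.* Q ℕ.+ ∑[ i < m ] (∣ B ∩ V (suc i) ∣ ℕ.* Q)
          ≤⟨ ℕ.+-mono-≤ (ℕ.*-monoˡ-≤ Q (∣p∩q∣≤∣q∣ B (V zero))) (∑-≤-const ∣B∩Vᵢ∣Q≤10Ps) ⟩
        b₀ ℕ.* Q ℕ.+ m ℕ.* (10 ℕ.* P ℕ.* s)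
          ≡⟨ cong (b₀ ℕ.* Q ℕ.+_) (x∙yz≈y∙xz m (10 ℕ.* P) s) ⟩
        b₀ ℕ.* Q ℕ.+ 10 ℕ.* P ℕ.* (m ℕ.* s) ∎

  record NaturalForm {n : ℕ} (m : ℕ) (p : ℚ) (V : Fin (suc m) → Subset n) (B : Subset n) : Set where
    field
      P q w′ L h s    : ℕ
      p≐              : p ≐ P ÷ suc q
      constraints     : Constraints n m s ∣ V zero ∣ P (suc q) (suc w′) L h
      ∣Vᵢ∣≡s          : ∀ i → ∣ V (suc i) ∣ ≡ s
      ∣B∩Vᵢ∣Q≤10Ps    : ∀ i → ∣ B ∩ V (suc i) ∣ ℕ.* suc q ℕ.≤ 10 ℕ.* P ℕ.* s
      ∣B∣Q≤b₀Q+10Pms  : ∣ B ∣ ℕ.* suc q ℕ.≤ ∣ V zero ∣ ℕ.* suc q ℕ.+ 10 ℕ.* P ℕ.* (m ℕ.* s)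

  module Construction {n r : ℕ} {G : Graph n} {c : Fin n → Fin n → Fin r} {ε d : ℚ} {m : ℕ}
    {V : Fin (suc m) → Subset n} {G′ : Graph n} (regular : IsRegularPartition G c ε d m V G′)
    {p : ℚ} {B : Subset n}
    (B-sparse : ∀ (i : Fin m) → ℕ→ℚ (card (B ∩ V (suc i))) ≤ (+ 10 / 1) * p * ℕ→ℚ (card (V (suc i))))
    (log : LogCondition n m p) (p<1/100 : p < + 1 / 100) (ε<1/10 : ε < + 1 / 10)
    {P′ q : ℕ} (p≐ : p ≐ suc P′ ÷ suc q) {E e : ℕ} (ε≐ : ε ≐ E ÷ suc e) where

    open PartitionSizes regular ε≐ (ε<1/10⇒10E<E′ ε≐ ε<1/10)
    P = suc P′
    Q = suc q
    100P<Q = p<1/100⇒100P<Q p≐ p<1/100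
    ∣B∩Vᵢ∣Q≤10Ps : ∀ i → ∣ B ∩ V (suc i) ∣ ℕ.* Q ℕ.≤ 10 ℕ.* P ℕ.* s
    ∣B∩Vᵢ∣Q≤10Ps i = subst (λ x → ∣ B ∩ V (suc i) ∣ ℕ.* Q ℕ.≤ 10 ℕ.* P ℕ.* x) (∣Vᵢ∣≡s i)
      (x≤10py⇒xQ≤10Py p≐ ∣ B ∩ V (suc i) ∣ ∣ V (suc i) ∣ (B-sparse i))

    module _ {w′ : ℕ} (10Pw≤Q : 10 ℕ.* P ℕ.* suc w′ ℕ.≤ Q) (Q<10P[1+w] : Q ℕ.< 10 ℕ.* P ℕ.* suc (suc w′))
             {A : ℕ} (A²m²Q²<P²n : A ℕ.* A ℕ.* (m ℕ.* m) ℕ.* (Q ℕ.* Q) ℕ.< P ℕ.* P ℕ.* n)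
             (n<expBound : n ℕ.< expBound (suc A)) where

      1≤n : 1 ℕ.≤ n
      1≤n = a<b*n⇒1≤n _ (P ℕ.* P) n A²m²Q²<P²n

      1210000A²<n : 1210000 ℕ.* (A ℕ.* A) ℕ.< n
      1210000A²<n = ℕ.*-cancelˡ-< (P ℕ.* P) _ _ (begin-strict
        P ℕ.* P ℕ.* (1210000 ℕ.* (A ℕ.* A))          ≡⟨ regroup P (A ℕ.* A) ⟩
        A ℕ.* A ℕ.* 121 ℕ.* (100 ℕ.* P ℕ.* (100 ℕ.* P))
          ≤⟨ ℕ.*-mono-≤ (ℕ.*-monoʳ-≤ (A ℕ.* A) (ℕ.*-mono-≤ 11≤m 11≤m)) (ℕ.*-mono-≤ (ℕ.<⇒≤ 100P<Q) (ℕ.<⇒≤ 100P<Q)) ⟩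
        A ℕ.* A ℕ.* (m ℕ.* m) ℕ.* (Q ℕ.* Q)          <⟨ A²m²Q²<P²n ⟩
        P ℕ.* P ℕ.* n                                 ∎)
        where
        regroup : ∀ P L → P ℕ.* P ℕ.* (1210000 ℕ.* L) ≡ L ℕ.* 121 ℕ.* (100 ℕ.* P ℕ.* (100 ℕ.* P))
        regroup = solve-∀

      4≤A : 4 ℕ.≤ A
      4≤A = n<expBound[1+A]⇒4≤A A n n<expBound 1210000A²<n (10≤n 1≤n)

      1≤A : 1 ℕ.≤ A
      1≤A = ℕ.≤-trans (s≤s z≤n) 4≤A

      naturalForm′ : NaturalForm m p V B
      naturalForm′ = record
        { P = P ; q = q ; w′ = w′ ; L = A ℕ.* A ; h = 4 ℕ.* suc A ℕ.* suc A ℕ.+ 4 ℕ.* suc A ℕ.+ 3 ; s = s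
        ; p≐ = p≐
        ; constraints = record
          { 1≤P = s≤s z≤n ; 100P<Q = 100P<Q ; 10Pw≤Q = 10Pw≤Q ; Q<10P[1+w] = Q<10P[1+w]
          ; 11≤m = 11≤m ; 1≤L = ℕ.*-mono-≤ 1≤A 1≤A ; Lm²Q²<P²n = A²m²Q²<P²n
          ; h≤8L = 4[1+A]²+4[1+A]+3≤8A² A 4≤A
          ; 5nm<2^h = 5nm<2^[4A²+4A+3] (suc A) n m (s≤s z≤n) n<expBound (m≤n 1≤n)
          ; 10b₀≤n = 10b₀≤n ; n≤b₀+ms = n≤b₀+ms ; ms≤n = ms≤n }
        ; ∣Vᵢ∣≡s = ∣Vᵢ∣≡s
        ; ∣B∩Vᵢ∣Q≤10Ps = ∣B∩Vᵢ∣Q≤10Ps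
        ; ∣B∣Q≤b₀Q+10Pms = ∣B∣Q≤b₀Q+10Pms B P Q ∣B∩Vᵢ∣Q≤10Ps
        }

    naturalForm : NaturalForm m p V B
    naturalForm = naturalForm′ {proj₁ scaled} (proj₁ (proj₂ scaled)) (proj₂ (proj₂ scaled))
                               {proj₁ logged} (proj₁ (proj₂ logged)) (proj₂ (proj₂ logged))
      where
      scaled = scale P Q 100P<Q
      logged = logCondition⇒ {n} {m} p≐ log

  GoodSet : ∀ {n m} → Graph n → (Fin (suc m) → Subset n) → Subset n → ℚ → Subset n → Set
  GoodSet {n} {m} G V B p A = A ⊆ ∁ B
    × (p * (+ 1 / 2) * ℕ→ℚ n ≤ ℕ→ℚ (card A))
    × (∀ (i : Fin m) → ℕ→ℚ (card (A ∩ V (suc i))) ≤ (+ 2 / 1) * p * ℕ→ℚ (card (V (suc i))))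
    × (∀ (v : Fin n) (i : Fin m) →
         (+ 30 / 1) * p * ℕ→ℚ (card (V (suc i))) < ℕ→ℚ (degIn (adj G) v (V (suc i))) →
         p * (+ 1 / 2) * ℕ→ℚ (degIn (adj G) v (V (suc i))) ≤ ℕ→ℚ (degIn (adj G) v (A ∩ V (suc i))))
    × (∀ (v : Fin n) →
         ℕ→ℚ n * (+ 1 / 40) < ℕ→ℚ (degIn (adj G) v (∁ B)) →
         ℕ→ℚ (card A) * (+ 1 / 100) ≤ ℕ→ℚ (degIn (adj G) v A))

  selected⇒good : ∀ {n m} {G : Graph n} {V : Fin (suc m) → Subset n} {B A : Subset n} {p : ℚ} {P q s : ℕ} →
    p ≐ P ÷ suc q → (∀ i → ∣ V (suc i) ∣ ≡ s) →
    Selected P (suc q) s B (V ∘ suc) (nbhd (adj G)) A → GoodSet G V B p A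
  selected⇒good {n} {m} {G} {V} {B} {A} {p} {P} {q} {s} p≐ ∣Vᵢ∣≡s selected =
    A⊆∁B , Px≤2Qy⇒px/2≤y p≐ n ∣ A ∣ Pn≤2Q∣A∣ , sparse , degInPart , degInA
    where
    open Selected selected
    N = nbhd (adj G)
    sparse : ∀ i → ℕ→ℚ ∣ A ∩ V (suc i) ∣ ≤ (+ 2 / 1) * p * ℕ→ℚ ∣ V (suc i) ∣
    sparse i = Qx≤2Py⇒x≤2py p≐ ∣ A ∩ V (suc i) ∣ ∣ V (suc i) ∣
      (subst (λ y → suc q ℕ.* ∣ A ∩ V (suc i) ∣ ℕ.≤ 2 ℕ.* P ℕ.* y) (sym (∣Vᵢ∣≡s i)) (Q∣A∩Vᵢ∣≤2Ps i))
    degInPart : ∀ v i → (+ 30 / 1) * p * ℕ→ℚ ∣ V (suc i) ∣ < ℕ→ℚ ∣ V (suc i) ∩ N v ∣ →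
                p * (+ 1 / 2) * ℕ→ℚ ∣ V (suc i) ∩ N v ∣ ≤ ℕ→ℚ ∣ (A ∩ V (suc i)) ∩ N v ∣
    degInPart v i heavy = Px≤2Qy⇒px/2≤y p≐ ∣ V (suc i) ∩ N v ∣ ∣ (A ∩ V (suc i)) ∩ N v ∣
      (P∣Vᵢ∩Nᵥ∣≤2Q∣A∩Vᵢ∩Nᵥ∣ v i
        (subst (λ y → 30 ℕ.* P ℕ.* y ℕ.< ∣ V (suc i) ∩ N v ∣ ℕ.* suc q) (∣Vᵢ∣≡s i)
          (30py<x⇒30Py<xQ p≐ ∣ V (suc i) ∩ N v ∣ ∣ V (suc i) ∣ heavy)))
    degInA : ∀ v → ℕ→ℚ n * (+ 1 / 40) < ℕ→ℚ ∣ ∁ B ∩ N v ∣ → ℕ→ℚ ∣ A ∣ * (+ 1 / 100) ≤ ℕ→ℚ ∣ A ∩ N v ∣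
    degInA v dense = y≤100x⇒y/100≤x ∣ A ∣ ∣ A ∩ N v ∣ (ℕ.*-cancelˡ-≤ (suc q) (begin
      suc q ℕ.* ∣ A ∣                      ≤⟨ Q∣A∣≤2Pn ⟩
      2 ℕ.* P ℕ.* n                        ≡⟨ ℕ.*-assoc 2 P n ⟩
      2 ℕ.* (P ℕ.* n)                      ≤⟨ ℕ.*-monoʳ-≤ 2 (Pn≤50Q∣A∩Nᵥ∣ v (n/40<x⇒n<40x n ∣ ∁ B ∩ N v ∣ dense)) ⟩
      2 ℕ.* (50 ℕ.* suc q ℕ.* ∣ A ∩ N v ∣) ≡⟨ regroup (suc q) ∣ A ∩ N v ∣ ⟩
      suc q ℕ.* (100 ℕ.* ∣ A ∩ N v ∣)      ∎))
      where
      regroup : ∀ Q x → 2 ℕ.* (50 ℕ.* Q ℕ.* x) ≡ Q ℕ.* (100 ℕ.* x)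
      regroup = solve-∀

open import Defs
open import Data.Nat using (ℕ; suc)
open import Data.Integer using (+_)
open import Data.Fin using (Fin; zero; suc)
open import Data.Fin.Subset using (Subset; _∈_; _⊆_; _∩_; ∁)
open import Data.Rational using (ℚ; _/_; 0ℚ; _*_; _≤_; _<_)
open import Data.Product using (_×_; ∃-syntax; map₂; proj₂)
open import Relation.Binary.PropositionalEquality using (_≡_)
open import Function using (_∘_)
open Fractions using (positive⇒≐; 1≤x*k⇒≐)
open RandomSelection using (module Selection)
open Reduction using (module NaturalForm; module Construction; selected⇒good)

proposition3p14 :
  ∀ (n : ℕ) (G : Graph n) (r : ℕ) (c : Fin n → Fin n → Fin r) →
  (∀ u v → c u v ≡ c v u) →
  ∀ (ε d : ℚ) (m : ℕ) (P : Fin (suc m) → Subset n) (G' : Graph n) →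
  IsRegularPartition G c ε d m P G' →
  ∀ (p : ℚ) → 0ℚ < p →
  ∀ (B : Subset n) → P zero ⊆ B →
  (∀ (i : Fin m) → ℕ→ℚ (card (B ∩ P (suc i))) ≤ (+ 10 / 1) * p * ℕ→ℚ (card (P (suc i)))) →
  LogCondition n m p → p < + 1 / 100 → ε < + 1 / 10 →
  ∃[ A ] (A ⊆ ∁ B
    × (p * (+ 1 / 2) * ℕ→ℚ n ≤ ℕ→ℚ (card A))
    × (∀ (i : Fin m) → ℕ→ℚ (card (A ∩ P (suc i))) ≤ (+ 2 / 1) * p * ℕ→ℚ (card (P (suc i))))
    × (∀ (v : Fin n) (i : Fin m) →
         (+ 30 / 1) * p * ℕ→ℚ (card (P (suc i))) < ℕ→ℚ (degIn (adj G) v (P (suc i))) →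
         p * (+ 1 / 2) * ℕ→ℚ (degIn (adj G) v (P (suc i)))
           ≤ ℕ→ℚ (degIn (adj G) v (A ∩ P (suc i))))
    × (∀ (v : Fin n) →
         ℕ→ℚ n * (+ 1 / 40) < ℕ→ℚ (degIn (adj G) v (∁ B)) →
         ℕ→ℚ (card A) * (+ 1 / 100) ≤ ℕ→ℚ (degIn (adj G) v A)))
proposition3p14 n G r c _ ε d m V G′ regular p 0<p B _ B-sparse log p<1/100 ε<1/10 =
  map₂ (selected⇒good {G = G} {V = V} {B = B} p≐ ∣Vᵢ∣≡s)
    (Selection.selection constraints B (V ∘ suc) ∣Vᵢ∣≡s ∣B∩Vᵢ∣Q≤10Ps ∣B∣Q≤b₀Q+10Pms (nbhd (adj G)))
  where
  open NaturalForm (Construction.naturalForm regular {B = B} B-sparse log p<1/100 ε<1/10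
    (proj₂ (proj₂ (positive⇒≐ p 0<p))) (proj₂ (proj₂ (1≤x*k⇒≐ ε m (IsRegularPartition.mBig regular)))))
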